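{- Let $R \cong R_1 \times R_2 \times \cdots \times R_n$ with $n \ge 2$, where each $R_i$ is a local commutative ring with unity with maximal ideal $\mathcal{M}_i$. Then the following are equivalent: (i) $\mathrm{PIS}(R)$ is a threshold graph; (ii) $\mathrm{PIS}(R)$ is a cograph; (iii) $R$ is isomorphic either to $F_1 \times F_2$ for fields $F_1, F_2$, or to $F_1 \times R_2$ where $F_1$ is a field and $R_2$ is a local ring with $\mathcal{I}^*(R_2) = \{\mathcal{M}_2\}$.
   Context: For a commutative ring $R$ with unity, $\mathcal{I}^*(R)$ denotes the set of nonzero proper ideals of $R$. The prime ideal sum graph $\mathrm{PIS}(R)$ is the simple undirected graph with vertex set $\mathcal{I}^*(R)$, two distinct vertices $I, J$ adjacent if and only if $I+J$ is a prime ideal of $R$. A cograph is a graph with no induced subgraph isomorphic to the path $P_4$ on four vertices. A threshold graph is a graph with no induced subgraph isomorphic to $P_4$, the cycle $C_4$, or $2K_2$ (two disjoint edges). -}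

module Defs where

open import Level using (Level; _⊔_) renaming (suc to lsuc)
open import Algebra.Bundles using (CommutativeRing)
open import Algebra.Morphism.Structures using (module RingMorphisms)
import Algebra.Construct.DirectProduct as DP
open import Data.Nat using (ℕ; zero; suc)
open import Data.Fin using (Fin; zero; suc)
open import Data.Product using (Σ; ∃; ∃-syntax; _×_; _,_)
open import Data.Sum using (_⊎_)
open import Relation.Nullary using (¬_)
open import Function using (_∘_)

_≅_ : ∀ {a b ℓ₁ ℓ₂} → CommutativeRing a ℓ₁ → CommutativeRing b ℓ₂ → Set (a ⊔ b ⊔ ℓ₁ ⊔ ℓ₂)
R ≅ S = Σ (CommutativeRing.Carrier R → CommutativeRing.Carrier S)
          (RingMorphisms.IsRingIsomorphism (CommutativeRing.rawRing R) (CommutativeRing.rawRing S))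

_×R_ : ∀ {c ℓ} → CommutativeRing c ℓ → CommutativeRing c ℓ → CommutativeRing c ℓ
R ×R S = DP.commutativeRing R S

ΠRing : ∀ {c ℓ} (n : ℕ) → (Fin (suc n) → CommutativeRing c ℓ) → CommutativeRing c ℓ
ΠRing zero    Rs = Rs zero
ΠRing (suc n) Rs = Rs zero ×R ΠRing n (Rs ∘ suc)

module _ {c ℓ} (R : CommutativeRing c ℓ) where
  open CommutativeRing R

  record Ideal : Set (lsuc (c ⊔ ℓ)) where
    field
      _∈I    : Carrier → Set (c ⊔ ℓ)
      resp   : ∀ {x y} → x ≈ y → x ∈I → y ∈I
      0∈     : 0# ∈I
      +-closed : ∀ {x y} → x ∈I → y ∈I → (x + y) ∈I
      *-closed : ∀ r {x} → x ∈I → (r * x) ∈I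

  open Ideal public

  _⊆I_ : Ideal → Ideal → Set (c ⊔ ℓ)
  I ⊆I J = ∀ x → (I ∈I) x → (J ∈I) x

  _≐_ : Ideal → Ideal → Set (c ⊔ ℓ)
  I ≐ J = (I ⊆I J) × (J ⊆I I)

  _⊕_ : Ideal → Ideal → Ideal
  I ⊕ J = record
    { _∈I = λ x → ∃[ a ] ∃[ b ] ((I ∈I) a × (J ∈I) b × x ≈ a + b)
    ; resp = λ { x≈y (a , b , a∈ , b∈ , x≈) → a , b , a∈ , b∈ , trans (sym x≈y) x≈ }
    ; 0∈ = 0# , 0# , 0∈ I , 0∈ J , sym (+-identityˡ 0#)
    ; +-closed = λ { (a , b , a∈ , b∈ , x≈) (a' , b' , a'∈ , b'∈ , y≈) →
        a + a' , b + b' , +-closed I a∈ a'∈ , +-closed J b∈ b'∈ ,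
        trans (+-cong x≈ y≈) (+-assoc-swap a b a' b') }
    ; *-closed = λ { r (a , b , a∈ , b∈ , x≈) →
        r * a , r * b , *-closed I r a∈ , *-closed J r b∈ ,
        trans (*-cong refl x≈) (distribˡ r a b) }
    }
    where
    open import Relation.Binary.Reasoning.Setoid setoid
    +-assoc-swap : ∀ a b a' b' → (a + b) + (a' + b') ≈ (a + a') + (b + b')
    +-assoc-swap a b a' b' = begin
      (a + b) + (a' + b')   ≈⟨ +-assoc a b (a' + b') ⟩
      a + (b + (a' + b'))   ≈⟨ +-cong refl (sym (+-assoc b a' b')) ⟩
      a + ((b + a') + b')   ≈⟨ +-cong refl (+-cong (+-comm b a') refl) ⟩
      a + ((a' + b) + b')   ≈⟨ +-cong refl (+-assoc a' b b') ⟩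
      a + (a' + (b + b'))   ≈⟨ sym (+-assoc a a' (b + b')) ⟩
      (a + a') + (b + b')   ∎

  IsProper : Ideal → Set (c ⊔ ℓ)
  IsProper I = ¬ (I ∈I) 1#

  IsNonzero : Ideal → Set (c ⊔ ℓ)
  IsNonzero I = ¬ (∀ x → (I ∈I) x → x ≈ 0#)

  IsNonzeroProper : Ideal → Set (c ⊔ ℓ)
  IsNonzeroProper I = IsNonzero I × IsProper I

  IsPrime : Ideal → Set (c ⊔ ℓ)
  IsPrime P = IsProper P × (∀ a b → (P ∈I) (a * b) → (P ∈I) a ⊎ (P ∈I) b)

  IsMaximal : Ideal → Set (lsuc (c ⊔ ℓ))
  IsMaximal M = IsProper M × (∀ J → M ⊆I J → (J ≐ M) ⊎ (J ∈I) 1#)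

  IsLocal : Set (lsuc (c ⊔ ℓ))
  IsLocal = ∃[ M ] (IsMaximal M × (∀ N → IsMaximal N → N ≐ M))

  IsField : Set (c ⊔ ℓ)
  IsField = (¬ (1# ≈ 0#)) × (∀ x → ¬ (x ≈ 0#) → ∃[ y ] (x * y ≈ 1#))

  OnlyMaximalNonzeroProper : Set (lsuc (c ⊔ ℓ))
  OnlyMaximalNonzeroProper =
    ∃[ M ] (IsMaximal M × IsNonzeroProper M × (∀ I → IsNonzeroProper I → I ≐ M))

record Graph (v e r : Level) : Set (lsuc (v ⊔ e ⊔ r)) where
  field
    Vertex : Set v
    _≈V_   : Vertex → Vertex → Set r
    Adj    : Vertex → Vertex → Set e

module _ {v e r} (G : Graph v e r) where
  open Graph G

  Distinct4 : Vertex → Vertex → Vertex → Vertex → Set r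
  Distinct4 a b c d = ¬ (a ≈V b) × ¬ (a ≈V c) × ¬ (a ≈V d)
                    × ¬ (b ≈V c) × ¬ (b ≈V d) × ¬ (c ≈V d)

  InducedP4 : Set (v ⊔ e ⊔ r)
  InducedP4 = ∃[ a ] ∃[ b ] ∃[ c ] ∃[ d ] (Distinct4 a b c d
    × Adj a b × Adj b c × Adj c d × ¬ Adj a c × ¬ Adj a d × ¬ Adj b d)

  InducedC4 : Set (v ⊔ e ⊔ r)
  InducedC4 = ∃[ a ] ∃[ b ] ∃[ c ] ∃[ d ] (Distinct4 a b c d
    × Adj a b × Adj b c × Adj c d × Adj d a × ¬ Adj a c × ¬ Adj b d)

  Induced2K2 : Set (v ⊔ e ⊔ r)
  Induced2K2 = ∃[ a ] ∃[ b ] ∃[ c ] ∃[ d ] (Distinct4 a b c d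
    × Adj a b × Adj c d × ¬ Adj a c × ¬ Adj a d × ¬ Adj b c × ¬ Adj b d)

  IsCograph : Set (v ⊔ e ⊔ r)
  IsCograph = ¬ InducedP4

  IsThreshold : Set (v ⊔ e ⊔ r)
  IsThreshold = ¬ InducedP4 × ¬ InducedC4 × ¬ Induced2K2

PIS : ∀ {c ℓ} (R : CommutativeRing c ℓ) → Graph (lsuc (c ⊔ ℓ)) (c ⊔ ℓ) (c ⊔ ℓ)
PIS R = record
  { Vertex = Σ (Ideal R) (IsNonzeroProper R)
  ; _≈V_   = λ I J → _≐_ R (proj I) (proj J)
  ; Adj    = λ I J → ¬ (_≐_ R (proj I) (proj J)) × IsPrime R (_⊕_ R (proj I) (proj J))
  }
  where
  proj : Σ (Ideal R) (IsNonzeroProper R) → Ideal R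
  proj (I , _) = I

ConditionIII : ∀ {c ℓ} → CommutativeRing c ℓ → Set (lsuc (c ⊔ ℓ))
ConditionIII {c} {ℓ} R =
    (Σ (CommutativeRing c ℓ) λ F₁ → Σ (CommutativeRing c ℓ) λ F₂ → (IsField F₁ × IsField F₂ × (R ≅ (F₁ ×R F₂))))
  ⊎ (Σ (CommutativeRing c ℓ) λ F₁ → Σ (CommutativeRing c ℓ) λ R₂ → (IsField F₁ × IsLocal R₂ × OnlyMaximalNonzeroProper R₂ × (R ≅ (F₁ ×R R₂))))

-- Each factor is local, and maximality of its maximal ideal M, applied to the ideal
-- {x | x ∈ M or P}, decides any proposition P; so the argument may be classical.
--
-- Cograph ⇒ (iii): PIS(A × (B × C)) has an induced P₄ built from prime ideals of the three factors;
-- so does PIS(A × B) for non-fields A, B with B not a domain, and for a domain A and a local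
-- non-field B having a nonzero non-prime ideal inside its maximal ideal M. Such an ideal exists
-- unless M is the only nonzero proper ideal of B, and always when B is a domain.
--
-- (iii) ⇒ threshold: for a field A and a ring B whose only ideals are 0, M and B, the vertex 0 × M
-- of PIS(A × B) is adjacent to every other vertex, and the others fall into the three classes
-- 0 × B, A × 0, A × M; so every four distinct vertices include 0 × M, which no induced P₄, C₄ or
-- 2K₂ allows.

module Submission where

open import Level using (_⊔_; Lift; lift; lower) renaming (suc to lsuc)
open import Algebra.Bundles using (CommutativeRing)
open import Algebra.Morphism.Structures using (module RingMorphisms)
import Algebra.Morphism.Construct.Composition as Composition
open import Axiom.ExcludedMiddle using (ExcludedMiddle)
open import Axiom.DoubleNegationElimination using (em⇒dne)
open import Data.Empty using (⊥; ⊥-elim)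
open import Data.Fin using (Fin; zero; suc)
open import Data.Nat using (ℕ; zero; suc)
open import Data.Product as Product using (∃-syntax; _×_; _,_; proj₁; proj₂; swap)
open import Data.Sum as Sum using (_⊎_; inj₁; inj₂)
open import Data.Unit.Polymorphic using (⊤)
open import Function using (_∘_)
open import Function.Bundles using (_⇔_; mk⇔)
open import Relation.Nullary using (¬_; yes; no)
open import Relation.Binary.PropositionalEquality as ≡ using (_≢_)
open import Relation.Nullary.Decidable using (map′; decidable-stable)
import Relation.Binary.Reasoning.Setoid as SetoidReasoning
open import Defs

module Ideals {c ℓ} (R : CommutativeRing c ℓ) where

  open CommutativeRing R public

  infix 4 _⊆_ _≃_
  infixl 6 _+ᴵ_

  _⊆_ : Ideal R → Ideal R → Set (c ⊔ ℓ)
  _⊆_ = _⊆I_ R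

  _≃_ : Ideal R → Ideal R → Set (c ⊔ ℓ)
  _≃_ = _≐_ R

  _+ᴵ_ : Ideal R → Ideal R → Ideal R
  _+ᴵ_ = _⊕_ R

  0ᴵ : Ideal R
  0ᴵ = record
    { _∈I = λ x → Lift c (x ≈ 0#)
    ; resp = λ { x≈y (lift x≈0) → lift (trans (sym x≈y) x≈0) }
    ; 0∈ = lift refl
    ; +-closed = λ { (lift x≈0) (lift y≈0) → lift (trans (+-cong x≈0 y≈0) (+-identityˡ 0#)) }
    ; *-closed = λ { r (lift x≈0) → lift (trans (*-cong refl x≈0) (zeroʳ r)) }
    }

  1ᴵ : Ideal R
  1ᴵ = record
    { _∈I = λ _ → ⊤
    ; resp = λ _ _ → _
    ; 0∈ = _
    ; +-closed = λ _ _ → _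
    ; *-closed = λ _ _ → _
    }

  ⟨_⟩ : Carrier → Ideal R
  ⟨ a ⟩ = record
    { _∈I = λ x → ∃[ r ] Lift c (x ≈ r * a)
    ; resp = λ { x≈y (r , lift x≈) → r , lift (trans (sym x≈y) x≈) }
    ; 0∈ = 0# , lift (sym (zeroˡ a))
    ; +-closed = λ { (r , lift x≈) (s , lift y≈) →
        r + s , lift (trans (+-cong x≈ y≈) (sym (distribʳ a r s))) }
    ; *-closed = λ { t (r , lift x≈) → t * r , lift (trans (*-cong refl x≈) (sym (*-assoc t r a))) }
    }

  a∈⟨a⟩ : ∀ a → (⟨ a ⟩ ∈I) a
  a∈⟨a⟩ a = 1# , lift (sym (*-identityˡ a))

  ⟨⟩-⊆ : ∀ {I a} → (I ∈I) a → ⟨ a ⟩ ⊆ I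
  ⟨⟩-⊆ {I} a∈I x (r , lift x≈) = resp I (sym x≈) (*-closed I r a∈I)

  ⊆-refl : ∀ {I} → I ⊆ I
  ⊆-refl _ x∈I = x∈I

  ⊆-trans : ∀ {I J K} → I ⊆ J → J ⊆ K → I ⊆ K
  ⊆-trans I⊆J J⊆K x = J⊆K x ∘ I⊆J x

  ≃-sym : ∀ {I J} → I ≃ J → J ≃ I
  ≃-sym (I⊆J , J⊆I) = J⊆I , I⊆J

  ≃-trans : ∀ {I J K} → I ≃ J → J ≃ K → I ≃ K
  ≃-trans {I} {J} {K} (I⊆J , J⊆I) (J⊆K , K⊆J) =
    ⊆-trans {I} {J} {K} I⊆J J⊆K , ⊆-trans {K} {J} {I} K⊆J J⊆I

  0ᴵ-⊆ : ∀ I → 0ᴵ ⊆ I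
  0ᴵ-⊆ I x (lift x≈0) = resp I (sym x≈0) (0∈ I)

  ⊆-1ᴵ : ∀ I → I ⊆ 1ᴵ
  ⊆-1ᴵ _ _ _ = _

  1∈⇒≃1ᴵ : ∀ {I} → (I ∈I) 1# → I ≃ 1ᴵ
  1∈⇒≃1ᴵ {I} 1∈I = ⊆-1ᴵ I , λ x _ → resp I (*-identityʳ x) (*-closed I x 1∈I)

  ⊆-+ᴵˡ : ∀ I J → I ⊆ I +ᴵ J
  ⊆-+ᴵˡ I J x x∈I = x , 0# , x∈I , 0∈ J , sym (+-identityʳ x)

  ⊆-+ᴵʳ : ∀ I J → J ⊆ I +ᴵ J
  ⊆-+ᴵʳ I J x x∈J = 0# , x , 0∈ I , x∈J , sym (+-identityˡ x)

  +ᴵ-lub : ∀ {I J K} → I ⊆ K → J ⊆ K → I +ᴵ J ⊆ K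
  +ᴵ-lub {K = K} I⊆K J⊆K x (a , b , a∈I , b∈J , x≈) =
    resp K (sym x≈) (+-closed K (I⊆K a a∈I) (J⊆K b b∈J))

  +ᴵ-mono : ∀ {I I′ J J′} → I ⊆ I′ → J ⊆ J′ → I +ᴵ J ⊆ I′ +ᴵ J′
  +ᴵ-mono I⊆I′ J⊆J′ x (a , b , a∈I , b∈J , x≈) = a , b , I⊆I′ a a∈I , J⊆J′ b b∈J , x≈

  +ᴵ-cong : ∀ {I I′ J J′} → I ≃ I′ → J ≃ J′ → I +ᴵ J ≃ I′ +ᴵ J′
  +ᴵ-cong {I} {I′} {J} {J′} (I⊆I′ , I′⊆I) (J⊆J′ , J′⊆J) =
    +ᴵ-mono {I} {I′} {J} {J′} I⊆I′ J⊆J′ , +ᴵ-mono {I′} {I} {J′} {J} I′⊆I J′⊆J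

  +ᴵ-comm : ∀ I J → I +ᴵ J ≃ J +ᴵ I
  +ᴵ-comm I J =
    +ᴵ-lub {I} {J} {J +ᴵ I} (⊆-+ᴵʳ J I) (⊆-+ᴵˡ J I) , +ᴵ-lub {J} {I} {I +ᴵ J} (⊆-+ᴵʳ I J) (⊆-+ᴵˡ I J)

  +ᴵ-absorbˡ : ∀ {I J} → I ⊆ J → I +ᴵ J ≃ J
  +ᴵ-absorbˡ {I} {J} I⊆J = +ᴵ-lub {I} {J} {J} I⊆J (⊆-refl {J}) , ⊆-+ᴵʳ I J

  +ᴵ-absorbʳ : ∀ {I J} → J ⊆ I → I +ᴵ J ≃ I
  +ᴵ-absorbʳ {I} {J} J⊆I = +ᴵ-lub {I} {J} {I} (⊆-refl {I}) J⊆I , ⊆-+ᴵˡ I J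

  0ᴵ-+ᴵ : ∀ I → 0ᴵ +ᴵ I ≃ I
  0ᴵ-+ᴵ I = +ᴵ-absorbˡ {0ᴵ} {I} (0ᴵ-⊆ I)

  +ᴵ-0ᴵ : ∀ I → I +ᴵ 0ᴵ ≃ I
  +ᴵ-0ᴵ I = +ᴵ-absorbʳ {I} {0ᴵ} (0ᴵ-⊆ I)

  1ᴵ-+ᴵ : ∀ I → 1ᴵ +ᴵ I ≃ 1ᴵ
  1ᴵ-+ᴵ I = +ᴵ-absorbʳ {1ᴵ} {I} (⊆-1ᴵ I)

  +ᴵ-1ᴵ : ∀ I → I +ᴵ 1ᴵ ≃ 1ᴵ
  +ᴵ-1ᴵ I = +ᴵ-absorbˡ {I} {1ᴵ} (⊆-1ᴵ I)

  +ᴵ-idem : ∀ I → I +ᴵ I ≃ I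
  +ᴵ-idem I = +ᴵ-absorbʳ {I} {I} (⊆-refl {I})

  IsProper-resp : ∀ {I J} → I ≃ J → IsProper R I → IsProper R J
  IsProper-resp (_ , J⊆I) I-proper 1∈J = I-proper (J⊆I 1# 1∈J)

  IsPrime-resp : ∀ {I J} → I ≃ J → IsPrime R I → IsPrime R J
  IsPrime-resp {I} {J} (I⊆J , J⊆I) (I-proper , I-prime) =
    IsProper-resp {I} {J} (I⊆J , J⊆I) I-proper ,
    λ a b ab∈J → Sum.map (I⊆J a) (I⊆J b) (I-prime a b (J⊆I _ ab∈J))

  proper⇒≄1ᴵ : ∀ {I} → IsProper R I → ¬ I ≃ 1ᴵ
  proper⇒≄1ᴵ I-proper (_ , 1⊆I) = I-proper (1⊆I 1# _)

  NonzeroNonprimeIdealIn : Ideal R → Set (lsuc (c ⊔ ℓ))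
  NonzeroNonprimeIdealIn M = ∃[ Y ] (Y ⊆ M × IsNonzero R Y × ¬ IsPrime R Y)

  OnlyIdeals0M1 : Ideal R → Set (lsuc (c ⊔ ℓ))
  OnlyIdeals0M1 M = ∀ I → I ≃ 0ᴵ ⊎ I ≃ M ⊎ I ≃ 1ᴵ

  unit⇒nonprime : ∀ {I} → (I ∈I) 1# → ¬ IsPrime R I
  unit⇒nonprime 1∈I (I-proper , _) = I-proper 1∈I

  proper⇒1ᴵ≄ : ∀ {I} → IsProper R I → ¬ 1ᴵ ≃ I
  proper⇒1ᴵ≄ {I} I-proper = proper⇒≄1ᴵ {I} I-proper ∘ ≃-sym {1ᴵ} {I}

  nonzero⇒≄0ᴵ : ∀ {I} → IsNonzero R I → ¬ I ≃ 0ᴵ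
  nonzero⇒≄0ᴵ I≢0 (I⊆0 , _) = I≢0 λ x x∈I → lower (I⊆0 x x∈I)

  proper⇒0ᴵ-proper : ∀ {I} → IsProper R I → IsProper R 0ᴵ
  proper⇒0ᴵ-proper {I} I-proper 1∈0 = I-proper (0ᴵ-⊆ I 1# 1∈0)

  proper⇒1ᴵ-nonzero : ∀ {I} → IsProper R I → IsNonzero R 1ᴵ
  proper⇒1ᴵ-nonzero {I} I-proper 1≈0 = I-proper (resp I (sym (1≈0 1# _)) (0∈ I))

  maximal⇒excludedMiddle : ∀ {M} → IsMaximal R M → ExcludedMiddle (c ⊔ ℓ)
  maximal⇒excludedMiddle {M} (M-proper , M-maximal) {P} with M-maximal M∨P (λ _ → inj₁)
    where
    M∨P : Ideal R
    M∨P = record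
      { _∈I = λ x → (M ∈I) x ⊎ P
      ; resp = λ x≈y → Sum.map₁ (resp M x≈y)
      ; 0∈ = inj₁ (0∈ M)
      ; +-closed = λ { (inj₁ x∈M) (inj₁ y∈M) → inj₁ (+-closed M x∈M y∈M)
                     ; (inj₂ p) _ → inj₂ p
                     ; _ (inj₂ p) → inj₂ p }
      ; *-closed = λ r → Sum.map₁ (*-closed M r)
      }
  ... | inj₁ (M∨P⊆M , _) = no λ p → M-proper (M∨P⊆M 1# (inj₂ p))
  ... | inj₂ (inj₁ 1∈M)   = ⊥-elim (M-proper 1∈M)
  ... | inj₂ (inj₂ p)     = yes p

module Classical {c ℓ} (R : CommutativeRing c ℓ) (em : ExcludedMiddle (c ⊔ ℓ)) where

  open Ideals R
  open SetoidReasoning setoid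

  dne : {P : Set (c ⊔ ℓ)} → ¬ ¬ P → P
  dne = em⇒dne em

  ≈-stable : ∀ {x y} → ¬ ¬ x ≈ y → x ≈ y
  ≈-stable {x} {y} = decidable-stable (map′ lower lift (em {Lift c (x ≈ y)}))

  nonzero⇒∃ : ∀ {I} → IsNonzero R I → ∃[ x ] ((I ∈I) x × ¬ x ≈ 0#)
  nonzero⇒∃ I≢0 = dne λ ∄ → I≢0 λ x x∈I → ≈-stable λ x≉0 → ∄ (x , x∈I , x≉0)

  ⊈⇒∃ : ∀ {I J} → ¬ I ⊆ J → ∃[ x ] ((I ∈I) x × ¬ (J ∈I) x)
  ⊈⇒∃ I⊈J = dne λ ∄ → I⊈J λ x x∈I → dne λ x∉J → ∄ (x , x∈I , x∉J)

  maximal⇒prime : ∀ {M} → IsMaximal R M → IsPrime R M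
  maximal⇒prime {M} (M-proper , M-maximal) = M-proper , prime
    where
    prime : ∀ a b → (M ∈I) (a * b) → (M ∈I) a ⊎ (M ∈I) b
    prime a b ab∈M with em {(M ∈I) a}
    ... | yes a∈M = inj₁ a∈M
    ... | no a∉M with M-maximal (M +ᴵ ⟨ a ⟩) (⊆-+ᴵˡ M ⟨ a ⟩)
    ...   | inj₁ (M+⟨a⟩⊆M , _) = ⊥-elim (a∉M (M+⟨a⟩⊆M a (⊆-+ᴵʳ M ⟨ a ⟩ a (a∈⟨a⟩ a))))
    ...   | inj₂ (m , x , m∈M , (r , lift x≈ra) , 1≈m+x) =
      inj₂ (resp M (sym b≈) (+-closed M (*-closed M b m∈M) (*-closed M r ab∈M)))
      where
      b≈ : b ≈ b * m + r * (a * b)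
      b≈ = begin
        b                    ≈⟨ *-identityʳ b ⟨
        b * 1#               ≈⟨ *-cong refl 1≈m+x ⟩
        b * (m + x)          ≈⟨ distribˡ b m x ⟩
        b * m + b * x        ≈⟨ +-cong refl (*-cong refl x≈ra) ⟩
        b * m + b * (r * a)  ≈⟨ +-cong refl (*-comm b (r * a)) ⟩
        b * m + (r * a) * b  ≈⟨ +-cong refl (*-assoc r a b) ⟩
        b * m + r * (a * b)  ∎

  field⇒0ᴵ-prime : IsField R → IsPrime R 0ᴵ
  field⇒0ᴵ-prime (1≉0 , inverse) = (λ 1∈0 → 1≉0 (lower 1∈0)) , prime
    where
    prime : ∀ a b → (0ᴵ ∈I) (a * b) → (0ᴵ ∈I) a ⊎ (0ᴵ ∈I) b
    prime a b (lift ab≈0) with em {Lift c (a ≈ 0#)}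
    ... | yes a≈0 = inj₁ a≈0
    ... | no a≉0 with inverse a (a≉0 ∘ lift)
    ...   | a⁻¹ , aa⁻¹≈1 = inj₂ (lift (begin
      b                ≈⟨ *-identityˡ b ⟨
      1# * b           ≈⟨ *-cong aa⁻¹≈1 refl ⟨
      (a * a⁻¹) * b    ≈⟨ *-cong (*-comm a a⁻¹) refl ⟩
      (a⁻¹ * a) * b    ≈⟨ *-assoc a⁻¹ a b ⟩
      a⁻¹ * (a * b)    ≈⟨ *-cong refl ab≈0 ⟩
      a⁻¹ * 0#         ≈⟨ zeroʳ a⁻¹ ⟩
      0#               ∎))

  ¬nonzero⇒≃0ᴵ : ∀ {I} → ¬ IsNonzero R I → I ≃ 0ᴵ
  ¬nonzero⇒≃0ᴵ {I} I≡0 = (λ x x∈I → lift (dne I≡0 x x∈I)) , 0ᴵ-⊆ I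

  field⇒ideal-trivial : IsField R → ∀ I → I ≃ 0ᴵ ⊎ I ≃ 1ᴵ
  field⇒ideal-trivial (_ , inverse) I with em {IsNonzero R I}
  ... | no I≡0 = inj₁ (¬nonzero⇒≃0ᴵ {I} I≡0)
  ... | yes I≢0 with nonzero⇒∃ {I} I≢0
  ...   | x , x∈I , x≉0 with inverse x x≉0
  ...     | x⁻¹ , xx⁻¹≈1 = inj₂ (1∈⇒≃1ᴵ {I} (resp I (trans (*-comm x⁻¹ x) xx⁻¹≈1) (*-closed I x⁻¹ x∈I)))

  onlyMaximal⇒onlyIdeals : ((M , _) : OnlyMaximalNonzeroProper R) → OnlyIdeals0M1 M
  onlyMaximal⇒onlyIdeals (M , _ , _ , only-M) I with em {IsNonzero R I}
  ... | no I≡0 = inj₁ (¬nonzero⇒≃0ᴵ {I} I≡0)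
  ... | yes I≢0 with em {(I ∈I) 1#}
  ...   | yes 1∈I = inj₂ (inj₂ (1∈⇒≃1ᴵ {I} 1∈I))
  ...   | no 1∉I  = inj₂ (inj₁ (only-M I (I≢0 , 1∉I)))

module Local {c ℓ} (R : CommutativeRing c ℓ) (em : ExcludedMiddle (c ⊔ ℓ))
             {M : Ideal R} (M-maximal : IsMaximal R M) where

  open Ideals R
  open Classical R em
  open SetoidReasoning setoid
  open import Algebra.Properties.Ring ring using (-‿distribʳ-*)

  M-proper : IsProper R M
  M-proper = proj₁ M-maximal

  M-prime : IsPrime R M
  M-prime = maximal⇒prime {M} M-maximal

  ¬field⇒M-nonzero : ¬ IsField R → IsNonzero R M
  ¬field⇒M-nonzero ¬field M≈0 = ¬field (1≉0 , inverse)
    where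
    1≉0 : ¬ 1# ≈ 0#
    1≉0 1≈0 = M-proper (resp M (sym 1≈0) (0∈ M))
    inverse : ∀ x → ¬ x ≈ 0# → ∃[ y ] (x * y ≈ 1#)
    inverse x x≉0 with proj₂ M-maximal (M +ᴵ ⟨ x ⟩) (⊆-+ᴵˡ M ⟨ x ⟩)
    ... | inj₁ (M+⟨x⟩⊆M , _) = ⊥-elim (x≉0 (M≈0 x (M+⟨x⟩⊆M x (⊆-+ᴵʳ M ⟨ x ⟩ x (a∈⟨a⟩ x)))))
    ... | inj₂ (m , w , m∈M , (r , lift w≈rx) , 1≈m+w) = r , (begin
      x * r   ≈⟨ *-comm x r ⟩
      r * x   ≈⟨ w≈rx ⟨
      w       ≈⟨ +-identityˡ w ⟨
      0# + w  ≈⟨ +-cong (M≈0 m m∈M) refl ⟨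
      m + w   ≈⟨ 1≈m+w ⟨
      1#      ∎)

  factor-out : ∀ y a r → y ≈ a + r * (y * y) → y * (1# + - (r * y)) ≈ a
  factor-out y a r y≈ = begin
    y * (1# + - (r * y))                  ≈⟨ distribˡ y 1# (- (r * y)) ⟩
    y * 1# + y * - (r * y)                ≈⟨ +-cong (*-identityʳ y) (sym (-‿distribʳ-* y (r * y))) ⟩
    y + - (y * (r * y))                   ≈⟨ +-cong y≈ (-‿cong yry≈ryy) ⟩
    (a + r * (y * y)) + - (r * (y * y))   ≈⟨ +-assoc a _ _ ⟩
    a + (r * (y * y) + - (r * (y * y)))   ≈⟨ +-cong refl (-‿inverseʳ _) ⟩
    a + 0#                                ≈⟨ +-identityʳ a ⟩
    a                                     ∎
    where
    yry≈ryy : y * (r * y) ≈ r * (y * y)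
    yry≈ryy = trans (sym (*-assoc y r y)) (trans (*-cong (*-comm y r) refl) (*-assoc r y y))

  -- Y + (y²) lies between the prime Y and M, contains y·y but not y: y = a + r y² with a ∈ Y gives
  -- y (1 - r y) ∈ Y, while 1 - r y ∉ M because r y ∈ M.
  nonprime-between : ∀ {Y} → IsPrime R Y → Y ⊆ M → ∀ {y} → (M ∈I) y → ¬ (Y ∈I) y →
                     NonzeroNonprimeIdealIn M
  nonprime-between {Y} (_ , Y-prime) Y⊆M {y} y∈M y∉Y = K , K⊆M , K-nonzero , K-nonprime
    where
    K : Ideal R
    K = Y +ᴵ ⟨ y * y ⟩
    yy∈K : (K ∈I) (y * y)
    yy∈K = ⊆-+ᴵʳ Y ⟨ y * y ⟩ (y * y) (a∈⟨a⟩ (y * y))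
    K⊆M : K ⊆ M
    K⊆M = +ᴵ-lub {Y} {⟨ y * y ⟩} {M} Y⊆M (⟨⟩-⊆ {M} (*-closed M y y∈M))
    yy∉Y : ¬ (Y ∈I) (y * y)
    yy∉Y yy∈Y = Sum.[ y∉Y , y∉Y ] (Y-prime y y yy∈Y)
    K-nonzero : IsNonzero R K
    K-nonzero K≈0 = yy∉Y (resp Y (sym (K≈0 (y * y) yy∈K)) (0∈ Y))
    y∉K : ¬ (K ∈I) y
    y∉K (a , b , a∈Y , (r , lift b≈) , y≈a+b)
      with Y-prime y (1# + - (r * y)) (resp Y (sym (factor-out y a r (trans y≈a+b (+-cong refl b≈)))) a∈Y)
    ... | inj₁ y∈Y = y∉Y y∈Y
    ... | inj₂ 1-ry∈Y = M-proper (resp M 1-ry+ry≈1 (+-closed M (Y⊆M _ 1-ry∈Y) (*-closed M r y∈M)))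
      where
      1-ry+ry≈1 : (1# + - (r * y)) + r * y ≈ 1#
      1-ry+ry≈1 = trans (+-assoc 1# _ _) (trans (+-cong refl (-‿inverseˡ _)) (+-identityʳ 1#))
    K-nonprime : ¬ IsPrime R K
    K-nonprime (_ , K-prime) = Sum.[ y∉K , y∉K ] (K-prime y y yy∈K)

  domain⇒nonprime-below : IsPrime R 0ᴵ → IsNonzero R M → NonzeroNonprimeIdealIn M
  domain⇒nonprime-below 0-prime M≢0 with nonzero⇒∃ {M} M≢0
  ... | m , m∈M , m≉0 = nonprime-between {0ᴵ} 0-prime (0ᴵ-⊆ M) m∈M (m≉0 ∘ lower)

  GeneratedByEachNonzero : Set (c ⊔ ℓ)
  GeneratedByEachNonzero = ∀ {x} → (M ∈I) x → ¬ x ≈ 0# → M ⊆ ⟨ x ⟩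

  ¬generated⇒nonprime-below : ¬ GeneratedByEachNonzero → NonzeroNonprimeIdealIn M
  ¬generated⇒nonprime-below ¬generated with witness
    where
    witness : ∃[ x ] ((M ∈I) x × ¬ x ≈ 0# × ¬ M ⊆ ⟨ x ⟩)
    witness = dne λ ∄ → ¬generated λ {x} x∈M x≉0 → dne λ M⊈⟨x⟩ → ∄ (x , x∈M , x≉0 , M⊈⟨x⟩)
  ... | x , x∈M , x≉0 , M⊈⟨x⟩ with ⊈⇒∃ {M} {⟨ x ⟩} M⊈⟨x⟩ | em {IsPrime R ⟨ x ⟩}
  ...   | y , y∈M , y∉⟨x⟩ | yes ⟨x⟩-prime = nonprime-between {⟨ x ⟩} ⟨x⟩-prime (⟨⟩-⊆ {M} x∈M) y∈M y∉⟨x⟩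
  ...   | _ | no ⟨x⟩-nonprime =
    ⟨ x ⟩ , ⟨⟩-⊆ {M} x∈M , (λ ⟨x⟩≈0 → x≉0 (⟨x⟩≈0 x (a∈⟨a⟩ x))) , ⟨x⟩-nonprime

  generated⇒minimal : GeneratedByEachNonzero → ∀ {Y} → IsNonzero R Y → Y ⊆ M → M ⊆ Y
  generated⇒minimal generated {Y} Y≢0 Y⊆M with nonzero⇒∃ {Y} Y≢0
  ... | x , x∈Y , x≉0 = ⊆-trans {M} {⟨ x ⟩} {Y} (generated (Y⊆M x x∈Y) x≉0) (⟨⟩-⊆ {Y} x∈Y)

  -- If J ⊋ I, some z ∈ J ∖ I has m·z ≠ 0 (else z = z·i ∈ I), so M ⊆ (m·z) ⊆ J and 1 = m + i ∈ J.
  generated⇒comaximal-maximal : GeneratedByEachNonzero → ∀ {I m i} → IsProper R I →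
    (M ∈I) m → (I ∈I) i → 1# ≈ m + i → IsMaximal R I
  generated⇒comaximal-maximal generated {I} {m} {i} I-proper m∈M i∈I 1≈m+i = I-proper , maximal
    where
    maximal : ∀ J → I ⊆ J → J ≃ I ⊎ (J ∈I) 1#
    maximal J I⊆J with em {J ⊆ I}
    ... | yes J⊆I = inj₁ (J⊆I , I⊆J)
    ... | no J⊈I with ⊈⇒∃ {J} {I} J⊈I
    ...   | z , z∈J , z∉I with em {Lift c (m * z ≈ 0#)}
    ...     | yes (lift mz≈0) = ⊥-elim (z∉I (resp I z·i≈z (*-closed I z i∈I)))
      where
      z·i≈z : z * i ≈ z
      z·i≈z = begin
        z * i            ≈⟨ +-identityˡ _ ⟨
        0# + z * i       ≈⟨ +-cong (trans (*-comm z m) mz≈0) refl ⟨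
        z * m + z * i    ≈⟨ distribˡ z m i ⟨
        z * (m + i)      ≈⟨ *-cong refl 1≈m+i ⟨
        z * 1#           ≈⟨ *-identityʳ z ⟩
        z                ∎
    ...     | no mz≉0 = inj₂ (resp J (sym 1≈m+i) (+-closed J m∈J (I⊆J i i∈I)))
      where
      M⊆J : M ⊆ J
      M⊆J = ⊆-trans {M} {⟨ m * z ⟩} {J}
        (generated (resp M (*-comm z m) (*-closed M z m∈M)) (mz≉0 ∘ lift)) (⟨⟩-⊆ {J} (*-closed J m z∈J))
      m∈J : (J ∈I) m
      m∈J = M⊆J m m∈M

  proper⊆M : (∀ N → IsMaximal R N → N ≃ M) → GeneratedByEachNonzero → ∀ {I} → IsProper R I → I ⊆ M
  proper⊆M unique generated {I} I-proper with proj₂ M-maximal (M +ᴵ I) (⊆-+ᴵˡ M I)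
  ... | inj₁ (M+I⊆M , _) = ⊆-trans {I} {M +ᴵ I} {M} (⊆-+ᴵʳ M I) M+I⊆M
  ... | inj₂ (m , i , m∈M , i∈I , 1≈m+i) =
    proj₁ (unique I (generated⇒comaximal-maximal generated {I} I-proper m∈M i∈I 1≈m+i))

  onlyMaximal-or-nonprime-below : (∀ N → IsMaximal R N → N ≃ M) → IsNonzero R M →
                         OnlyMaximalNonzeroProper R ⊎ NonzeroNonprimeIdealIn M
  onlyMaximal-or-nonprime-below unique M≢0 with em {GeneratedByEachNonzero}
  ... | yes generated = inj₁ (M , M-maximal , (M≢0 , M-proper) , only-M)
    where
    only-M : ∀ I → IsNonzeroProper R I → I ≃ M
    only-M I (I≢0 , I-proper) = I⊆M , generated⇒minimal generated {I} I≢0 I⊆M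
      where
      I⊆M : I ⊆ M
      I⊆M = proper⊆M unique generated {I} I-proper
  ... | no ¬generated = inj₂ (¬generated⇒nonprime-below ¬generated)

record InducedEmbedding {v e r v′ e′ r′} (H : Graph v′ e′ r′) (G : Graph v e r)
                        : Set (v ⊔ e ⊔ r ⊔ v′ ⊔ e′ ⊔ r′) where
  private
    module G = Graph G
    module H = Graph H
  field
    vertex         : H.Vertex → G.Vertex
    reflects-≈     : ∀ {u w} → vertex u G.≈V vertex w → u H.≈V w
    preserves-Adj  : ∀ {u w} → H.Adj u w → G.Adj (vertex u) (vertex w)
    preserves-¬Adj : ∀ {u w} → ¬ H.Adj u w → ¬ G.Adj (vertex u) (vertex w)

module _ {v e r v′ e′ r′} {H : Graph v′ e′ r′} {G : Graph v e r} (φ : InducedEmbedding H G) where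

  open InducedEmbedding φ

  private
    distinct : ∀ {a b c d} → Distinct4 H a b c d → Distinct4 G (vertex a) (vertex b) (vertex c) (vertex d)
    distinct (a≉b , a≉c , a≉d , b≉c , b≉d , c≉d) =
      a≉b ∘ reflects-≈ , a≉c ∘ reflects-≈ , a≉d ∘ reflects-≈ ,
      b≉c ∘ reflects-≈ , b≉d ∘ reflects-≈ , c≉d ∘ reflects-≈

  InducedP4-map : InducedP4 H → InducedP4 G
  InducedP4-map (a , b , c , d , D , ab , bc , cd , ¬ac , ¬ad , ¬bd) =
    vertex a , vertex b , vertex c , vertex d , distinct D ,
    preserves-Adj ab , preserves-Adj bc , preserves-Adj cd ,
    preserves-¬Adj ¬ac , preserves-¬Adj ¬ad , preserves-¬Adj ¬bd

  InducedC4-map : InducedC4 H → InducedC4 G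
  InducedC4-map (a , b , c , d , D , ab , bc , cd , da , ¬ac , ¬bd) =
    vertex a , vertex b , vertex c , vertex d , distinct D ,
    preserves-Adj ab , preserves-Adj bc , preserves-Adj cd , preserves-Adj da ,
    preserves-¬Adj ¬ac , preserves-¬Adj ¬bd

  Induced2K2-map : Induced2K2 H → Induced2K2 G
  Induced2K2-map (a , b , c , d , D , ab , cd , ¬ac , ¬ad , ¬bc , ¬bd) =
    vertex a , vertex b , vertex c , vertex d , distinct D ,
    preserves-Adj ab , preserves-Adj cd ,
    preserves-¬Adj ¬ac , preserves-¬Adj ¬ad , preserves-¬Adj ¬bc , preserves-¬Adj ¬bd

  IsCograph-reflect : IsCograph G → IsCograph H
  IsCograph-reflect G-cograph = G-cograph ∘ InducedP4-map

  IsThreshold-reflect : IsThreshold G → IsThreshold H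
  IsThreshold-reflect (¬P4 , ¬C4 , ¬2K2) = ¬P4 ∘ InducedP4-map , ¬C4 ∘ InducedC4-map , ¬2K2 ∘ Induced2K2-map

module _ {v e r} (G : Graph v e r) where

  open Graph G

  AdjacentToAll : Vertex → Vertex → Vertex → Vertex → Set e
  AdjacentToAll a x y z = Adj a x × Adj a y × Adj a z

  HasDominatingVertex : Vertex → Vertex → Vertex → Vertex → Set e
  HasDominatingVertex a b c d =
    AdjacentToAll a b c d ⊎ AdjacentToAll b a c d ⊎ AdjacentToAll c a b d ⊎ AdjacentToAll d a b c

  -- Every vertex of P₄, C₄ and 2K₂ has a non-neighbour among the other three.
  threshold-if-quadruples-dominated : (∀ {u w} → Adj u w → Adj w u) →
    (∀ a b c d → Distinct4 G a b c d → HasDominatingVertex a b c d) → IsThreshold G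
  threshold-if-quadruples-dominated Adj-sym dominated = ¬P4 , ¬C4 , ¬2K2
    where
    ¬P4 : ¬ InducedP4 G
    ¬P4 (a , b , c , d , D , _ , _ , _ , ¬ac , ¬ad , ¬bd) with dominated a b c d D
    ... | inj₁ (_ , ac , _)               = ¬ac ac
    ... | inj₂ (inj₁ (_ , _ , bd))        = ¬bd bd
    ... | inj₂ (inj₂ (inj₁ (ca , _)))     = ¬ac (Adj-sym ca)
    ... | inj₂ (inj₂ (inj₂ (da , _)))     = ¬ad (Adj-sym da)
    ¬C4 : ¬ InducedC4 G
    ¬C4 (a , b , c , d , D , _ , _ , _ , _ , ¬ac , ¬bd) with dominated a b c d D
    ... | inj₁ (_ , ac , _)               = ¬ac ac
    ... | inj₂ (inj₁ (_ , _ , bd))        = ¬bd bd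
    ... | inj₂ (inj₂ (inj₁ (ca , _)))     = ¬ac (Adj-sym ca)
    ... | inj₂ (inj₂ (inj₂ (_ , db , _))) = ¬bd (Adj-sym db)
    ¬2K2 : ¬ Induced2K2 G
    ¬2K2 (a , b , c , d , D , _ , _ , ¬ac , ¬ad , ¬bc , ¬bd) with dominated a b c d D
    ... | inj₁ (_ , ac , _)               = ¬ac ac
    ... | inj₂ (inj₁ (_ , bc , _))        = ¬bc bc
    ... | inj₂ (inj₂ (inj₁ (ca , _)))     = ¬ac (Adj-sym ca)
    ... | inj₂ (inj₂ (inj₂ (da , _)))     = ¬ad (Adj-sym da)

module PIS-Adj {c ℓ} (R : CommutativeRing c ℓ) where

  open Ideals R

  -- Graph.Adj (PIS R) u w unfolds to Adjacent (proj₁ u) (proj₁ w).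
  Adjacent : Ideal R → Ideal R → Set (c ⊔ ℓ)
  Adjacent I J = ¬ I ≃ J × IsPrime R (I +ᴵ J)

  Adjacent-sym : ∀ I J → Adjacent I J → Adjacent J I
  Adjacent-sym I J (I≄J , I+J-prime) =
    I≄J ∘ ≃-sym {J} {I} , IsPrime-resp {I +ᴵ J} {J +ᴵ I} (+ᴵ-comm I J) I+J-prime

  Adjacent-intro : ∀ I J K → ¬ I ≃ J → I +ᴵ J ≃ K → IsPrime R K → Adjacent I J
  Adjacent-intro I J K I≄J I+J≃K K-prime =
    I≄J , IsPrime-resp {K} {I +ᴵ J} (≃-sym {I +ᴵ J} {K} I+J≃K) K-prime

  ¬Adjacent-intro : ∀ I J K → I +ᴵ J ≃ K → ¬ IsPrime R K → ¬ Adjacent I J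
  ¬Adjacent-intro I J K I+J≃K K-nonprime (_ , I+J-prime) =
    K-nonprime (IsPrime-resp {I +ᴵ J} {K} I+J≃K I+J-prime)

module _ {c ℓ} (R S : CommutativeRing c ℓ) where

  private
    module R = CommutativeRing R
    module S = CommutativeRing S
  open RingMorphisms R.rawRing S.rawRing

  mkRingIsomorphism : (f : R.Carrier → S.Carrier) →
    (∀ {x y} → x R.≈ y → f x S.≈ f y) →
    (∀ x y → f (x R.+ y) S.≈ f x S.+ f y) → f R.0# S.≈ S.0# →
    (∀ x y → f (x R.* y) S.≈ f x S.* f y) → f R.1# S.≈ S.1# →
    (∀ x → f (R.- x) S.≈ S.- f x) →
    (∀ {x y} → f x S.≈ f y → x R.≈ y) →
    (∀ y → ∃[ x ] (∀ {z} → z R.≈ x → f z S.≈ y)) →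
    IsRingIsomorphism f
  mkRingIsomorphism f cong +-homo 0-homo *-homo 1-homo -‿homo injective surjective = record
    { isRingMonomorphism = record
      { isRingHomomorphism = record
        { isSemiringHomomorphism = record
          { isNearSemiringHomomorphism = record
            { +-isMonoidHomomorphism = record
              { isMagmaHomomorphism = record { isRelHomomorphism = record { cong = cong } ; homo = +-homo }
              ; ε-homo = 0-homo }
            ; *-homo = *-homo }
          ; 1#-homo = 1-homo }
        ; -‿homo = -‿homo }
      ; injective = injective }
    ; surjective = surjective }

≅-sym : ∀ {c ℓ} {R S : CommutativeRing c ℓ} → R ≅ S → S ≅ R
≅-sym {R = R} {S} (f , f-iso) =
  g , mkRingIsomorphism S R g g-cong +-homo′ 0-homo′ *-homo′ 1-homo′ -‿homo′ g-injective g-surjective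
  where
  module R = CommutativeRing R
  module S = CommutativeRing S
  open RingMorphisms.IsRingIsomorphism f-iso
  g : S.Carrier → R.Carrier
  g y = proj₁ (surjective y)
  fg : ∀ y → f (g y) S.≈ y
  fg y = proj₂ (surjective y) R.refl
  g-cong : ∀ {x y} → x S.≈ y → g x R.≈ g y
  g-cong x≈y = injective (S.trans (fg _) (S.trans x≈y (S.sym (fg _))))
  +-homo′ : ∀ x y → g (x S.+ y) R.≈ g x R.+ g y
  +-homo′ x y = injective (S.trans (fg _) (S.sym (S.trans (+-homo (g x) (g y)) (S.+-cong (fg x) (fg y)))))
  0-homo′ : g S.0# R.≈ R.0#
  0-homo′ = injective (S.trans (fg _) (S.sym 0#-homo))
  *-homo′ : ∀ x y → g (x S.* y) R.≈ g x R.* g y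
  *-homo′ x y = injective (S.trans (fg _) (S.sym (S.trans (*-homo (g x) (g y)) (S.*-cong (fg x) (fg y)))))
  1-homo′ : g S.1# R.≈ R.1#
  1-homo′ = injective (S.trans (fg _) (S.sym 1#-homo))
  -‿homo′ : ∀ x → g (S.- x) R.≈ R.- g x
  -‿homo′ x = injective (S.trans (fg _) (S.sym (S.trans (-‿homo (g x)) (S.-‿cong (fg x)))))
  g-injective : ∀ {x y} → g x R.≈ g y → x S.≈ y
  g-injective gx≈gy = S.trans (S.sym (fg _)) (S.trans (⟦⟧-cong gx≈gy) (fg _))
  g-surjective : ∀ x → ∃[ y ] (∀ {z} → z S.≈ y → g z R.≈ x)
  g-surjective x = f x , λ z≈fx → R.trans (g-cong z≈fx) (injective (fg (f x)))

≅-trans : ∀ {c ℓ} {R S T : CommutativeRing c ℓ} → R ≅ S → S ≅ T → R ≅ T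
≅-trans {T = T} (f , f-iso) (g , g-iso) =
  g ∘ f , Composition.isRingIsomorphism (CommutativeRing.trans T) f-iso g-iso

×R-comm : ∀ {c ℓ} (A B : CommutativeRing c ℓ) → (A ×R B) ≅ (B ×R A)
×R-comm A B = swap , mkRingIsomorphism (A ×R B) (B ×R A) swap swap
  (λ _ _ → refl′) refl′ (λ _ _ → refl′) refl′ (λ _ → refl′) swap (λ y → swap y , swap)
  where
  refl′ : ∀ {x} → CommutativeRing._≈_ (B ×R A) x x
  refl′ = CommutativeRing.refl (B ×R A)

module Preimage {c ℓ} {R S : CommutativeRing c ℓ} (iso : R ≅ S) where

  private
    module R where
      open Ideals R public
      open PIS-Adj R public
    module S where
      open Ideals S public
      open PIS-Adj S public
    f = proj₁ iso
  open RingMorphisms.IsRingIsomorphism (proj₂ iso)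

  pre : S.Carrier → R.Carrier
  pre y = proj₁ (surjective y)

  f∘pre : ∀ y → f (pre y) S.≈ y
  f∘pre y = proj₂ (surjective y) R.refl

  f⁻¹[_] : Ideal S → Ideal R
  f⁻¹[ J ] = record
    { _∈I = λ x → (J ∈I) (f x)
    ; resp = λ x≈y → resp J (⟦⟧-cong x≈y)
    ; 0∈ = resp J (S.sym 0#-homo) (0∈ J)
    ; +-closed = λ {x} {y} fx∈J fy∈J → resp J (S.sym (+-homo x y)) (+-closed J fx∈J fy∈J)
    ; *-closed = λ r {x} fx∈J → resp J (S.sym (*-homo r x)) (*-closed J (f r) fx∈J)
    }

  f⁻¹-≃ : ∀ {J K} → J S.≃ K → f⁻¹[ J ] R.≃ f⁻¹[ K ]
  f⁻¹-≃ (J⊆K , K⊆J) = (λ x → J⊆K (f x)) , (λ x → K⊆J (f x))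

  f⁻¹-⊆⁻ : ∀ {J K} → f⁻¹[ J ] R.⊆ f⁻¹[ K ] → J S.⊆ K
  f⁻¹-⊆⁻ {J} {K} ⊆ y y∈J = resp K (f∘pre y) (⊆ (pre y) (resp J (S.sym (f∘pre y)) y∈J))

  f⁻¹-≃⁻ : ∀ {J K} → f⁻¹[ J ] R.≃ f⁻¹[ K ] → J S.≃ K
  f⁻¹-≃⁻ {J} {K} (⊆ , ⊇) = f⁻¹-⊆⁻ {J} {K} ⊆ , f⁻¹-⊆⁻ {K} {J} ⊇

  f⁻¹-+ᴵ : ∀ J K → f⁻¹[ J S.+ᴵ K ] R.≃ f⁻¹[ J ] R.+ᴵ f⁻¹[ K ]
  f⁻¹-+ᴵ J K = ⊆ , ⊇
    where
    ⊆ : f⁻¹[ J S.+ᴵ K ] R.⊆ f⁻¹[ J ] R.+ᴵ f⁻¹[ K ]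
    ⊆ x (a , b , a∈J , b∈K , fx≈a+b) =
      pre a , pre b , resp J (S.sym (f∘pre a)) a∈J , resp K (S.sym (f∘pre b)) b∈K ,
      injective (S.trans fx≈a+b (S.sym (S.trans (+-homo (pre a) (pre b)) (S.+-cong (f∘pre a) (f∘pre b)))))
    ⊇ : f⁻¹[ J ] R.+ᴵ f⁻¹[ K ] R.⊆ f⁻¹[ J S.+ᴵ K ]
    ⊇ x (a , b , fa∈J , fb∈K , x≈a+b) = f a , f b , fa∈J , fb∈K , S.trans (⟦⟧-cong x≈a+b) (+-homo a b)

  f⁻¹-proper : ∀ {J} → IsProper S J → IsProper R f⁻¹[ J ]
  f⁻¹-proper {J} J-proper f1∈J = J-proper (resp J 1#-homo f1∈J)

  f⁻¹-nonzero : ∀ {J} → IsNonzero S J → IsNonzero R f⁻¹[ J ]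
  f⁻¹-nonzero {J} J≢0 f⁻¹J≈0 = J≢0 λ y y∈J →
    S.trans (S.sym (f∘pre y)) (S.trans (⟦⟧-cong (f⁻¹J≈0 (pre y) (resp J (S.sym (f∘pre y)) y∈J))) 0#-homo)

  f⁻¹-prime : ∀ {J} → IsPrime S J → IsPrime R f⁻¹[ J ]
  f⁻¹-prime {J} (J-proper , J-prime) =
    f⁻¹-proper {J} J-proper , λ a b fab∈J → J-prime (f a) (f b) (resp J (*-homo a b) fab∈J)

  f⁻¹-prime⁻ : ∀ {J} → IsPrime R f⁻¹[ J ] → IsPrime S J
  f⁻¹-prime⁻ {J} (f⁻¹J-proper , f⁻¹J-prime) =
    (λ 1∈J → f⁻¹J-proper (resp J (S.sym 1#-homo) 1∈J)) ,
    λ a b ab∈J → Sum.map (resp J (f∘pre a)) (resp J (f∘pre b))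
      (f⁻¹J-prime (pre a) (pre b)
        (resp J (S.sym (S.trans (*-homo (pre a) (pre b)) (S.*-cong (f∘pre a) (f∘pre b)))) ab∈J))

  f⁻¹-Adjacent : ∀ J K → S.Adjacent J K → R.Adjacent f⁻¹[ J ] f⁻¹[ K ]
  f⁻¹-Adjacent J K (J≄K , J+K-prime) =
    J≄K ∘ f⁻¹-≃⁻ {J} {K} ,
    R.IsPrime-resp {f⁻¹[ J S.+ᴵ K ]} {f⁻¹[ J ] R.+ᴵ f⁻¹[ K ]} (f⁻¹-+ᴵ J K) (f⁻¹-prime {J S.+ᴵ K} J+K-prime)

  f⁻¹-Adjacent⁻ : ∀ J K → R.Adjacent f⁻¹[ J ] f⁻¹[ K ] → S.Adjacent J K
  f⁻¹-Adjacent⁻ J K (f⁻¹J≄f⁻¹K , f⁻¹J+f⁻¹K-prime) =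
    f⁻¹J≄f⁻¹K ∘ f⁻¹-≃ {J} {K} ,
    f⁻¹-prime⁻ {J S.+ᴵ K} (R.IsPrime-resp {f⁻¹[ J ] R.+ᴵ f⁻¹[ K ]} {f⁻¹[ J S.+ᴵ K ]}
      (R.≃-sym {f⁻¹[ J S.+ᴵ K ]} {f⁻¹[ J ] R.+ᴵ f⁻¹[ K ]} (f⁻¹-+ᴵ J K)) f⁻¹J+f⁻¹K-prime)

  PIS-preimage : InducedEmbedding (PIS S) (PIS R)
  PIS-preimage = record
    { vertex = λ (J , J≢0 , J-proper) → f⁻¹[ J ] , f⁻¹-nonzero {J} J≢0 , f⁻¹-proper {J} J-proper
    ; reflects-≈ = λ {(J , _)} {(K , _)} → f⁻¹-≃⁻ {J} {K}
    ; preserves-Adj = λ {(J , _)} {(K , _)} → f⁻¹-Adjacent J K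
    ; preserves-¬Adj = λ {(J , _)} {(K , _)} ¬JK → ¬JK ∘ f⁻¹-Adjacent⁻ J K
    }

module ProductIdeals {c ℓ} (A B : CommutativeRing c ℓ) where

  module A = Ideals A
  module B = Ideals B
  module P = Ideals (A ×R B)

  infixr 7 _⊗_

  _⊗_ : Ideal A → Ideal B → Ideal (A ×R B)
  I ⊗ J = record
    { _∈I = λ (a , b) → (I ∈I) a × (J ∈I) b
    ; resp = λ (a≈ , b≈) (a∈I , b∈J) → resp I a≈ a∈I , resp J b≈ b∈J
    ; 0∈ = 0∈ I , 0∈ J
    ; +-closed = λ (a∈I , b∈J) (a′∈I , b′∈J) → +-closed I a∈I a′∈I , +-closed J b∈J b′∈J
    ; *-closed = λ (r , s) (a∈I , b∈J) → *-closed I r a∈I , *-closed J s b∈J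
    }

  fstᴵ : Ideal (A ×R B) → Ideal A
  fstᴵ K = record
    { _∈I = λ a → (K ∈I) (a , B.0#)
    ; resp = λ a≈ → resp K (a≈ , B.refl)
    ; 0∈ = 0∈ K
    ; +-closed = λ k k′ → resp K (A.refl , B.+-identityˡ B.0#) (+-closed K k k′)
    ; *-closed = λ r k → resp K (A.refl , B.zeroˡ B.0#) (*-closed K (r , B.0#) k)
    }

  sndᴵ : Ideal (A ×R B) → Ideal B
  sndᴵ K = record
    { _∈I = λ b → (K ∈I) (A.0# , b)
    ; resp = λ b≈ → resp K (A.refl , b≈)
    ; 0∈ = 0∈ K
    ; +-closed = λ k k′ → resp K (A.+-identityˡ A.0# , B.refl) (+-closed K k k′)
    ; *-closed = λ r k → resp K (A.zeroˡ A.0# , B.refl) (*-closed K (A.0# , r) k)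
    }

  ≃fstᴵ⊗sndᴵ : ∀ K → K P.≃ fstᴵ K ⊗ sndᴵ K
  ≃fstᴵ⊗sndᴵ K = K⊆ , ⊆K
    where
    K⊆ : K P.⊆ fstᴵ K ⊗ sndᴵ K
    K⊆ (a , b) k = resp K (A.*-identityˡ a , B.zeroˡ b) (*-closed K (A.1# , B.0#) k) ,
                   resp K (A.zeroˡ a , B.*-identityˡ b) (*-closed K (A.0# , B.1#) k)
    ⊆K : fstᴵ K ⊗ sndᴵ K P.⊆ K
    ⊆K (a , b) (ka , kb) = resp K (A.+-identityʳ a , B.+-identityˡ b) (+-closed K ka kb)

  ⊗-cong : ∀ {I I′ J J′} → I A.≃ I′ → J B.≃ J′ → I ⊗ J P.≃ I′ ⊗ J′
  ⊗-cong (I⊆I′ , I′⊆I) (J⊆J′ , J′⊆J) =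
    (λ (a , b) (a∈ , b∈) → I⊆I′ a a∈ , J⊆J′ b b∈) , (λ (a , b) (a∈ , b∈) → I′⊆I a a∈ , J′⊆J b b∈)

  +ᴵ-⊗ : ∀ I I′ J J′ → (I ⊗ J) P.+ᴵ (I′ ⊗ J′) P.≃ (I A.+ᴵ I′) ⊗ (J B.+ᴵ J′)
  +ᴵ-⊗ I I′ J J′ =
    (λ _ ((a , b) , (a′ , b′) , (a∈ , b∈) , (a′∈ , b′∈) , (x≈ , y≈)) →
       (a , a′ , a∈ , a′∈ , x≈) , (b , b′ , b∈ , b′∈ , y≈)) ,
    (λ _ ((a , a′ , a∈ , a′∈ , x≈) , (b , b′ , b∈ , b′∈ , y≈)) →
       (a , b) , (a′ , b′) , (a∈ , b∈) , (a′∈ , b′∈) , (x≈ , y≈))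

  ⊗-≄ˡ : ∀ {I I′ J J′} → ¬ I A.≃ I′ → ¬ I ⊗ J P.≃ I′ ⊗ J′
  ⊗-≄ˡ {J = J} {J′} I≄I′ (⊆ , ⊇) =
    I≄I′ ((λ a a∈ → proj₁ (⊆ (a , B.0#) (a∈ , 0∈ J))) , (λ a a∈ → proj₁ (⊇ (a , B.0#) (a∈ , 0∈ J′))))

  ⊗-≄ʳ : ∀ {I I′ J J′} → ¬ J B.≃ J′ → ¬ I ⊗ J P.≃ I′ ⊗ J′
  ⊗-≄ʳ {I} {I′} J≄J′ (⊆ , ⊇) =
    J≄J′ ((λ b b∈ → proj₂ (⊆ (A.0# , b) (0∈ I , b∈))) , (λ b b∈ → proj₂ (⊇ (A.0# , b) (0∈ I′ , b∈))))

  ⊗-nonzeroˡ : ∀ {I J} → IsNonzero A I → IsNonzero (A ×R B) (I ⊗ J)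
  ⊗-nonzeroˡ {J = J} I≢0 I⊗J≈0 = I≢0 λ a a∈ → proj₁ (I⊗J≈0 (a , B.0#) (a∈ , 0∈ J))

  ⊗-nonzeroʳ : ∀ {I J} → IsNonzero B J → IsNonzero (A ×R B) (I ⊗ J)
  ⊗-nonzeroʳ {I} J≢0 I⊗J≈0 = J≢0 λ b b∈ → proj₂ (I⊗J≈0 (A.0# , b) (0∈ I , b∈))

  ⊗-properˡ : ∀ {I J} → IsProper A I → IsProper (A ×R B) (I ⊗ J)
  ⊗-properˡ I-proper (1∈I , _) = I-proper 1∈I

  ⊗-properʳ : ∀ {I J} → IsProper B J → IsProper (A ×R B) (I ⊗ J)
  ⊗-properʳ J-proper (_ , 1∈J) = J-proper 1∈J

  ⊗1ᴵ-prime : ∀ {I} → IsPrime A I → IsPrime (A ×R B) (I ⊗ B.1ᴵ)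
  ⊗1ᴵ-prime {I} (I-proper , I-prime) =
    ⊗-properˡ {I} {B.1ᴵ} I-proper ,
    λ x y xy∈ → Sum.map (_, _) (_, _) (I-prime (proj₁ x) (proj₁ y) (proj₁ xy∈))

  1ᴵ⊗-prime : ∀ {J} → IsPrime B J → IsPrime (A ×R B) (A.1ᴵ ⊗ J)
  1ᴵ⊗-prime {J} (J-proper , J-prime) =
    ⊗-properʳ {A.1ᴵ} {J} J-proper ,
    λ x y xy∈ → Sum.map (_ ,_) (_ ,_) (J-prime (proj₂ x) (proj₂ y) (proj₂ xy∈))

  1ᴵ⊗-prime⁻¹ : ∀ {J} → IsPrime (A ×R B) (A.1ᴵ ⊗ J) → IsPrime B J
  1ᴵ⊗-prime⁻¹ (1⊗J-proper , 1⊗J-prime) =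
    (λ 1∈J → 1⊗J-proper (_ , 1∈J)) ,
    λ a b ab∈J → Sum.map proj₂ proj₂ (1⊗J-prime (A.1# , a) (A.1# , b) (_ , ab∈J))

  ⊗-nonprime : ∀ {I J} → IsProper A I → IsProper B J → ¬ IsPrime (A ×R B) (I ⊗ J)
  ⊗-nonprime {I} {J} I-proper J-proper (_ , I⊗J-prime) =
    Sum.[ I-proper ∘ proj₁ , J-proper ∘ proj₂ ] (I⊗J-prime (A.1# , B.0#) (A.0# , B.1#) 10·01∈I⊗J)
    where
    10·01∈I⊗J : ((I ⊗ J) ∈I) ((A.1# , B.0#) P.* (A.0# , B.1#))
    10·01∈I⊗J = resp I (A.sym (A.zeroʳ A.1#)) (0∈ I) , resp J (B.sym (B.zeroˡ B.1#)) (0∈ J)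

  1ᴵ⊗1ᴵ-nonprime : ¬ IsPrime (A ×R B) (A.1ᴵ ⊗ B.1ᴵ)
  1ᴵ⊗1ᴵ-nonprime = P.unit⇒nonprime {A.1ᴵ ⊗ B.1ᴵ} _

  ≃⊗-from-components : ∀ {K} I J → fstᴵ K A.≃ I → sndᴵ K B.≃ J → K P.≃ I ⊗ J
  ≃⊗-from-components {K} I J fst≃I snd≃J =
    P.≃-trans {K} {fstᴵ K ⊗ sndᴵ K} {I ⊗ J} (≃fstᴵ⊗sndᴵ K) (⊗-cong {fstᴵ K} {I} {sndᴵ K} {J} fst≃I snd≃J)

  ⊗-+ᴵ-≃ : ∀ I J I′ J′ I″ J″ → I A.+ᴵ I′ A.≃ I″ → J B.+ᴵ J′ B.≃ J″ →
           (I ⊗ J) P.+ᴵ (I′ ⊗ J′) P.≃ I″ ⊗ J″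
  ⊗-+ᴵ-≃ I J I′ J′ I″ J″ I+I′≃I″ J+J′≃J″ =
    P.≃-trans {(I ⊗ J) P.+ᴵ (I′ ⊗ J′)} {(I A.+ᴵ I′) ⊗ (J B.+ᴵ J′)} {I″ ⊗ J″}
      (+ᴵ-⊗ I I′ J J′) (⊗-cong {I A.+ᴵ I′} {I″} {J B.+ᴵ J′} {J″} I+I′≃I″ J+J′≃J″)

  open PIS-Adj (A ×R B)

  Adjacent-⊗ : ∀ I J I′ J′ I″ J″ → ¬ I ⊗ J P.≃ I′ ⊗ J′ →
               I A.+ᴵ I′ A.≃ I″ → J B.+ᴵ J′ B.≃ J″ → IsPrime (A ×R B) (I″ ⊗ J″) →
               Adjacent (I ⊗ J) (I′ ⊗ J′)
  Adjacent-⊗ I J I′ J′ I″ J″ I⊗J≄I′⊗J′ I+I′≃I″ J+J′≃J″ =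
    Adjacent-intro (I ⊗ J) (I′ ⊗ J′) (I″ ⊗ J″) I⊗J≄I′⊗J′ (⊗-+ᴵ-≃ I J I′ J′ I″ J″ I+I′≃I″ J+J′≃J″)

  ¬Adjacent-⊗ : ∀ I J I′ J′ I″ J″ →
                I A.+ᴵ I′ A.≃ I″ → J B.+ᴵ J′ B.≃ J″ → ¬ IsPrime (A ×R B) (I″ ⊗ J″) →
                ¬ Adjacent (I ⊗ J) (I′ ⊗ J′)
  ¬Adjacent-⊗ I J I′ J′ I″ J″ I+I′≃I″ J+J′≃J″ =
    ¬Adjacent-intro (I ⊗ J) (I′ ⊗ J′) (I″ ⊗ J″) (⊗-+ᴵ-≃ I J I′ J′ I″ J″ I+I′≃I″ J+J′≃J″)

module FieldProductThreshold {c ℓ} (A B : CommutativeRing c ℓ) (em : ExcludedMiddle (c ⊔ ℓ))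
  (A-field : IsField A) {M : Ideal B} (M-prime : IsPrime B M) (B-ideals : Ideals.OnlyIdeals0M1 B M) where

  open ProductIdeals A B
  open Graph (PIS (A ×R B)) using (Vertex; Adj; _≈V_)
  open PIS-Adj (A ×R B)

  data Shape : Set where
    0⊗1 1⊗0 1⊗M : Shape

  ⟦_⟧ : Shape → Ideal (A ×R B)
  ⟦ 0⊗1 ⟧ = A.0ᴵ ⊗ B.1ᴵ
  ⟦ 1⊗0 ⟧ = A.1ᴵ ⊗ B.0ᴵ
  ⟦ 1⊗M ⟧ = A.1ᴵ ⊗ M

  pigeonhole : (s₀ s₁ s₂ s₃ : Shape) → s₀ ≢ s₁ → s₀ ≢ s₂ → s₀ ≢ s₃ → s₁ ≢ s₂ → s₁ ≢ s₃ → s₂ ≢ s₃ → ⊥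
  pigeonhole 0⊗1 0⊗1 _ _ ≢ _ _ _ _ _ = ≢ ≡.refl
  pigeonhole 1⊗0 1⊗0 _ _ ≢ _ _ _ _ _ = ≢ ≡.refl
  pigeonhole 1⊗M 1⊗M _ _ ≢ _ _ _ _ _ = ≢ ≡.refl
  pigeonhole 0⊗1 _ 0⊗1 _ _ ≢ _ _ _ _ = ≢ ≡.refl
  pigeonhole 1⊗0 _ 1⊗0 _ _ ≢ _ _ _ _ = ≢ ≡.refl
  pigeonhole 1⊗M _ 1⊗M _ _ ≢ _ _ _ _ = ≢ ≡.refl
  pigeonhole 0⊗1 _ _ 0⊗1 _ _ ≢ _ _ _ = ≢ ≡.refl
  pigeonhole 1⊗0 _ _ 1⊗0 _ _ ≢ _ _ _ = ≢ ≡.refl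
  pigeonhole 1⊗M _ _ 1⊗M _ _ ≢ _ _ _ = ≢ ≡.refl
  pigeonhole _ 0⊗1 0⊗1 _ _ _ _ ≢ _ _ = ≢ ≡.refl
  pigeonhole _ 1⊗0 1⊗0 _ _ _ _ ≢ _ _ = ≢ ≡.refl
  pigeonhole _ 1⊗M 1⊗M _ _ _ _ ≢ _ _ = ≢ ≡.refl
  pigeonhole _ 0⊗1 _ 0⊗1 _ _ _ _ ≢ _ = ≢ ≡.refl
  pigeonhole _ 1⊗0 _ 1⊗0 _ _ _ _ ≢ _ = ≢ ≡.refl
  pigeonhole _ 1⊗M _ 1⊗M _ _ _ _ ≢ _ = ≢ ≡.refl
  pigeonhole _ _ 0⊗1 0⊗1 _ _ _ _ _ ≢ = ≢ ≡.refl
  pigeonhole _ _ 1⊗0 1⊗0 _ _ _ _ _ ≢ = ≢ ≡.refl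
  pigeonhole _ _ 1⊗M 1⊗M _ _ _ _ _ ≢ = ≢ ≡.refl

  0ᴵ-prime : IsPrime A A.0ᴵ
  0ᴵ-prime = Classical.field⇒0ᴵ-prime A em A-field

  vertex-shape : (u : Vertex) → proj₁ u P.≃ A.0ᴵ ⊗ M ⊎ ∃[ s ] (proj₁ u P.≃ ⟦ s ⟧)
  vertex-shape (K , K≢0 , K-proper)
    with Classical.field⇒ideal-trivial A em A-field (fstᴵ K) | B-ideals (sndᴵ K)
  ... | inj₁ fst≃0 | inj₁ snd≃0 =
    ⊥-elim (K≢0 λ x x∈K →
      Product.map lower lower (proj₁ (≃⊗-from-components {K} A.0ᴵ B.0ᴵ fst≃0 snd≃0) x x∈K))
  ... | inj₁ fst≃0 | inj₂ (inj₁ snd≃M) = inj₁ (≃⊗-from-components {K} A.0ᴵ M fst≃0 snd≃M)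
  ... | inj₁ fst≃0 | inj₂ (inj₂ snd≃1) = inj₂ (0⊗1 , ≃⊗-from-components {K} A.0ᴵ B.1ᴵ fst≃0 snd≃1)
  ... | inj₂ fst≃1 | inj₁ snd≃0        = inj₂ (1⊗0 , ≃⊗-from-components {K} A.1ᴵ B.0ᴵ fst≃1 snd≃0)
  ... | inj₂ fst≃1 | inj₂ (inj₁ snd≃M) = inj₂ (1⊗M , ≃⊗-from-components {K} A.1ᴵ M fst≃1 snd≃M)
  ... | inj₂ fst≃1 | inj₂ (inj₂ snd≃1) =
    ⊥-elim (K-proper (proj₂ (≃⊗-from-components {K} A.1ᴵ B.1ᴵ fst≃1 snd≃1) _ _))

  centre-Adj : ∀ {u w} I′ J′ I″ J″ → proj₁ u P.≃ A.0ᴵ ⊗ M → proj₁ w P.≃ I′ ⊗ J′ → ¬ u ≈V w →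
               A.0ᴵ A.+ᴵ I′ A.≃ I″ → M B.+ᴵ J′ B.≃ J″ → IsPrime (A ×R B) (I″ ⊗ J″) → Adj u w
  centre-Adj {u} {w} I′ J′ I″ J″ u≃ w≃ u≉w 0+I′≃I″ M+J′≃J″ =
    Adjacent-intro (proj₁ u) (proj₁ w) (I″ ⊗ J″) u≉w
      (P.≃-trans {proj₁ u P.+ᴵ proj₁ w} {(A.0ᴵ ⊗ M) P.+ᴵ (I′ ⊗ J′)} {I″ ⊗ J″}
        (P.+ᴵ-cong {proj₁ u} {A.0ᴵ ⊗ M} {proj₁ w} {I′ ⊗ J′} u≃ w≃)
        (⊗-+ᴵ-≃ A.0ᴵ M I′ J′ I″ J″ 0+I′≃I″ M+J′≃J″))

  centre-dominating : ∀ u w → proj₁ u P.≃ A.0ᴵ ⊗ M → ¬ u ≈V w → Adj u w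
  centre-dominating u w u≃ u≉w with vertex-shape w
  ... | inj₁ w≃ = ⊥-elim (u≉w (P.≃-trans {proj₁ u} {A.0ᴵ ⊗ M} {proj₁ w} u≃ (P.≃-sym {proj₁ w} {A.0ᴵ ⊗ M} w≃)))
  ... | inj₂ (0⊗1 , w≃) = centre-Adj {u} {w} A.0ᴵ B.1ᴵ A.0ᴵ B.1ᴵ u≃ w≃ u≉w
                            (A.+ᴵ-idem A.0ᴵ) (B.+ᴵ-1ᴵ M) (⊗1ᴵ-prime {A.0ᴵ} 0ᴵ-prime)
  ... | inj₂ (1⊗0 , w≃) = centre-Adj {u} {w} A.1ᴵ B.0ᴵ A.1ᴵ M u≃ w≃ u≉w
                            (A.0ᴵ-+ᴵ A.1ᴵ) (B.+ᴵ-0ᴵ M) (1ᴵ⊗-prime {M} M-prime)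
  ... | inj₂ (1⊗M , w≃) = centre-Adj {u} {w} A.1ᴵ M A.1ᴵ M u≃ w≃ u≉w
                            (A.0ᴵ-+ᴵ A.1ᴵ) (B.+ᴵ-idem M) (1ᴵ⊗-prime {M} M-prime)

  shapes-differ : ∀ {u w s t} → proj₁ u P.≃ ⟦ s ⟧ → proj₁ w P.≃ ⟦ t ⟧ → ¬ u ≈V w → s ≢ t
  shapes-differ {u} {w} {s} u≃ w≃ u≉w ≡.refl =
    u≉w (P.≃-trans {proj₁ u} {⟦ s ⟧} {proj₁ w} u≃ (P.≃-sym {proj₁ w} {⟦ s ⟧} w≃))

  ≉-sym : ∀ u w → ¬ u ≈V w → ¬ w ≈V u
  ≉-sym u w u≉w = u≉w ∘ P.≃-sym {proj₁ w} {proj₁ u}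

  quadruples-dominated : ∀ a b c d → Distinct4 (PIS (A ×R B)) a b c d →
                         HasDominatingVertex (PIS (A ×R B)) a b c d
  quadruples-dominated a b c d (a≉b , a≉c , a≉d , b≉c , b≉d , c≉d)
    with vertex-shape a | vertex-shape b | vertex-shape c | vertex-shape d
  ... | inj₁ a≃ | _ | _ | _ =
    inj₁ (centre-dominating a b a≃ a≉b , centre-dominating a c a≃ a≉c , centre-dominating a d a≃ a≉d)
  ... | inj₂ _ | inj₁ b≃ | _ | _ =
    inj₂ (inj₁ (centre-dominating b a b≃ (≉-sym a b a≉b) , centre-dominating b c b≃ b≉c ,
                centre-dominating b d b≃ b≉d))
  ... | inj₂ _ | inj₂ _ | inj₁ c≃ | _ =
    inj₂ (inj₂ (inj₁ (centre-dominating c a c≃ (≉-sym a c a≉c) , centre-dominating c b c≃ (≉-sym b c b≉c) ,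
                      centre-dominating c d c≃ c≉d)))
  ... | inj₂ _ | inj₂ _ | inj₂ _ | inj₁ d≃ =
    inj₂ (inj₂ (inj₂ (centre-dominating d a d≃ (≉-sym a d a≉d) , centre-dominating d b d≃ (≉-sym b d b≉d) ,
                      centre-dominating d c d≃ (≉-sym c d c≉d))))
  ... | inj₂ (s₀ , a≃) | inj₂ (s₁ , b≃) | inj₂ (s₂ , c≃) | inj₂ (s₃ , d≃) =
    ⊥-elim (pigeonhole s₀ s₁ s₂ s₃
      (shapes-differ {a} {b} a≃ b≃ a≉b) (shapes-differ {a} {c} a≃ c≃ a≉c) (shapes-differ {a} {d} a≃ d≃ a≉d)
      (shapes-differ {b} {c} b≃ c≃ b≉c) (shapes-differ {b} {d} b≃ d≃ b≉d) (shapes-differ {c} {d} c≃ d≃ c≉d))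

  PIS-threshold : IsThreshold (PIS (A ×R B))
  PIS-threshold = threshold-if-quadruples-dominated (PIS (A ×R B))
    (λ {u} {w} → Adjacent-sym (proj₁ u) (proj₁ w)) quadruples-dominated

module ProductP4 {c ℓ} (A B : CommutativeRing c ℓ) where

  open ProductIdeals A B

  -- 0 × Y — 0 × B — 0 × M — A × 0
  P4-domain×nonprime : IsPrime A A.0ᴵ → ∀ {M} → IsPrime B M → IsNonzero B M →
                       B.NonzeroNonprimeIdealIn M → InducedP4 (PIS (A ×R B))
  P4-domain×nonprime A-domain@(0-proper , _) {M} M-prime@(M-proper , _) M≢0 (Y , Y⊆M , Y≢0 , Y-nonprime) =
    a , b , c′ , d , (a≉b , a≉c , a≉d , b≉c , b≉d , c≉d) ,
    Adjacent-⊗ A.0ᴵ Y A.0ᴵ B.1ᴵ A.0ᴵ B.1ᴵ a≉b (A.+ᴵ-idem A.0ᴵ) (B.+ᴵ-1ᴵ Y) (⊗1ᴵ-prime {A.0ᴵ} A-domain) ,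
    Adjacent-⊗ A.0ᴵ B.1ᴵ A.0ᴵ M A.0ᴵ B.1ᴵ b≉c (A.+ᴵ-idem A.0ᴵ) (B.1ᴵ-+ᴵ M) (⊗1ᴵ-prime {A.0ᴵ} A-domain) ,
    Adjacent-⊗ A.0ᴵ M A.1ᴵ B.0ᴵ A.1ᴵ M c≉d (A.0ᴵ-+ᴵ A.1ᴵ) (B.+ᴵ-0ᴵ M) (1ᴵ⊗-prime {M} M-prime) ,
    ¬Adjacent-⊗ A.0ᴵ Y A.0ᴵ M A.0ᴵ M (A.+ᴵ-idem A.0ᴵ) (B.+ᴵ-absorbˡ {Y} {M} Y⊆M)
      (⊗-nonprime {A.0ᴵ} {M} 0-proper M-proper) ,
    ¬Adjacent-⊗ A.0ᴵ Y A.1ᴵ B.0ᴵ A.1ᴵ Y (A.0ᴵ-+ᴵ A.1ᴵ) (B.+ᴵ-0ᴵ Y) (Y-nonprime ∘ 1ᴵ⊗-prime⁻¹ {Y}) ,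
    ¬Adjacent-⊗ A.0ᴵ B.1ᴵ A.1ᴵ B.0ᴵ A.1ᴵ B.1ᴵ (A.0ᴵ-+ᴵ A.1ᴵ) (B.+ᴵ-0ᴵ B.1ᴵ) 1ᴵ⊗1ᴵ-nonprime
    where
    Y-proper : IsProper B Y
    Y-proper 1∈Y = M-proper (Y⊆M B.1# 1∈Y)
    a b c′ d : Graph.Vertex (PIS (A ×R B))
    a = A.0ᴵ ⊗ Y , ⊗-nonzeroʳ {A.0ᴵ} {Y} Y≢0 , ⊗-properˡ {A.0ᴵ} {Y} 0-proper
    b = A.0ᴵ ⊗ B.1ᴵ , ⊗-nonzeroʳ {A.0ᴵ} {B.1ᴵ} (B.proper⇒1ᴵ-nonzero {M} M-proper) ,
        ⊗-properˡ {A.0ᴵ} {B.1ᴵ} 0-proper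
    c′ = A.0ᴵ ⊗ M , ⊗-nonzeroʳ {A.0ᴵ} {M} M≢0 , ⊗-properˡ {A.0ᴵ} {M} 0-proper
    d = A.1ᴵ ⊗ B.0ᴵ , ⊗-nonzeroˡ {A.1ᴵ} {B.0ᴵ} (A.proper⇒1ᴵ-nonzero {A.0ᴵ} 0-proper) ,
        ⊗-properʳ {A.1ᴵ} {B.0ᴵ} (B.proper⇒0ᴵ-proper {M} M-proper)
    0≄1 : ¬ A.0ᴵ A.≃ A.1ᴵ
    0≄1 = A.proper⇒≄1ᴵ {A.0ᴵ} 0-proper
    a≉b = ⊗-≄ʳ {A.0ᴵ} {A.0ᴵ} {Y} {B.1ᴵ} (B.proper⇒≄1ᴵ {Y} Y-proper)
    a≉c = ⊗-≄ʳ {A.0ᴵ} {A.0ᴵ} {Y} {M} λ Y≃M → Y-nonprime (B.IsPrime-resp {M} {Y} (B.≃-sym {Y} {M} Y≃M) M-prime)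
    a≉d = ⊗-≄ˡ {A.0ᴵ} {A.1ᴵ} {Y} {B.0ᴵ} 0≄1
    b≉c = ⊗-≄ʳ {A.0ᴵ} {A.0ᴵ} {B.1ᴵ} {M} (B.proper⇒1ᴵ≄ {M} M-proper)
    b≉d = ⊗-≄ˡ {A.0ᴵ} {A.1ᴵ} {B.1ᴵ} {B.0ᴵ} 0≄1
    c≉d = ⊗-≄ˡ {A.0ᴵ} {A.1ᴵ} {M} {B.0ᴵ} 0≄1

  -- 0 × B — M × 0 — A × N — A × 0
  P4-primes×nondomain : ∀ {M} → IsPrime A M → IsNonzero A M → ∀ {N} → IsPrime B N → IsNonzero B N →
                        ¬ IsPrime B B.0ᴵ → InducedP4 (PIS (A ×R B))
  P4-primes×nondomain {M} M-prime@(M-proper , _) M≢0 {N} N-prime@(N-proper , _) N≢0 B-nondomain =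
    a , b , c′ , d , (a≉b , a≉c , a≉d , b≉c , b≉d , c≉d) ,
    Adjacent-⊗ A.0ᴵ B.1ᴵ M B.0ᴵ M B.1ᴵ a≉b (A.0ᴵ-+ᴵ M) (B.+ᴵ-0ᴵ B.1ᴵ) (⊗1ᴵ-prime {M} M-prime) ,
    Adjacent-⊗ M B.0ᴵ A.1ᴵ N A.1ᴵ N b≉c (A.+ᴵ-1ᴵ M) (B.0ᴵ-+ᴵ N) (1ᴵ⊗-prime {N} N-prime) ,
    Adjacent-⊗ A.1ᴵ N A.1ᴵ B.0ᴵ A.1ᴵ N c≉d (A.+ᴵ-idem A.1ᴵ) (B.+ᴵ-0ᴵ N) (1ᴵ⊗-prime {N} N-prime) ,
    ¬Adjacent-⊗ A.0ᴵ B.1ᴵ A.1ᴵ N A.1ᴵ B.1ᴵ (A.0ᴵ-+ᴵ A.1ᴵ) (B.1ᴵ-+ᴵ N) 1ᴵ⊗1ᴵ-nonprime ,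
    ¬Adjacent-⊗ A.0ᴵ B.1ᴵ A.1ᴵ B.0ᴵ A.1ᴵ B.1ᴵ (A.0ᴵ-+ᴵ A.1ᴵ) (B.+ᴵ-0ᴵ B.1ᴵ) 1ᴵ⊗1ᴵ-nonprime ,
    ¬Adjacent-⊗ M B.0ᴵ A.1ᴵ B.0ᴵ A.1ᴵ B.0ᴵ (A.+ᴵ-1ᴵ M) (B.+ᴵ-idem B.0ᴵ) (B-nondomain ∘ 1ᴵ⊗-prime⁻¹ {B.0ᴵ})
    where
    0-proper : IsProper A A.0ᴵ
    0-proper = A.proper⇒0ᴵ-proper {M} M-proper
    a b c′ d : Graph.Vertex (PIS (A ×R B))
    a = A.0ᴵ ⊗ B.1ᴵ , ⊗-nonzeroʳ {A.0ᴵ} {B.1ᴵ} (B.proper⇒1ᴵ-nonzero {N} N-proper) ,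
        ⊗-properˡ {A.0ᴵ} {B.1ᴵ} 0-proper
    b = M ⊗ B.0ᴵ , ⊗-nonzeroˡ {M} {B.0ᴵ} M≢0 , ⊗-properˡ {M} {B.0ᴵ} M-proper
    c′ = A.1ᴵ ⊗ N , ⊗-nonzeroˡ {A.1ᴵ} {N} (A.proper⇒1ᴵ-nonzero {M} M-proper) , ⊗-properʳ {A.1ᴵ} {N} N-proper
    d = A.1ᴵ ⊗ B.0ᴵ , ⊗-nonzeroˡ {A.1ᴵ} {B.0ᴵ} (A.proper⇒1ᴵ-nonzero {M} M-proper) ,
        ⊗-properʳ {A.1ᴵ} {B.0ᴵ} (B.proper⇒0ᴵ-proper {N} N-proper)
    0≄1 : ¬ A.0ᴵ A.≃ A.1ᴵ
    0≄1 = A.proper⇒≄1ᴵ {A.0ᴵ} 0-proper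
    M≄1 : ¬ M A.≃ A.1ᴵ
    M≄1 = A.proper⇒≄1ᴵ {M} M-proper
    a≉b = ⊗-≄ʳ {A.0ᴵ} {M} {B.1ᴵ} {B.0ᴵ} (B.nonzero⇒≄0ᴵ {B.1ᴵ} (B.proper⇒1ᴵ-nonzero {N} N-proper))
    a≉c = ⊗-≄ˡ {A.0ᴵ} {A.1ᴵ} {B.1ᴵ} {N} 0≄1
    a≉d = ⊗-≄ˡ {A.0ᴵ} {A.1ᴵ} {B.1ᴵ} {B.0ᴵ} 0≄1
    b≉c = ⊗-≄ˡ {M} {A.1ᴵ} {B.0ᴵ} {N} M≄1
    b≉d = ⊗-≄ˡ {M} {A.1ᴵ} {B.0ᴵ} {B.0ᴵ} M≄1
    c≉d = ⊗-≄ʳ {A.1ᴵ} {A.1ᴵ} {N} {B.0ᴵ} (B.nonzero⇒≄0ᴵ {N} N≢0)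

module ThreeFactorP4 {c ℓ} (A B C : CommutativeRing c ℓ) where

  open ProductIdeals A (B ×R C) using (_⊗_; Adjacent-⊗; ¬Adjacent-⊗; ⊗1ᴵ-prime; 1ᴵ⊗-prime;
    ⊗-≄ˡ; ⊗-≄ʳ; ⊗-nonzeroˡ; ⊗-nonzeroʳ; ⊗-properˡ; ⊗-properʳ)
  module Inner = ProductIdeals B C
  private
    module A = Ideals A
    module B = Ideals B
    module C = Ideals C
    module B×C = Ideals (B ×R C)
    module A×B×C = Ideals (A ×R (B ×R C))

  -- A × (B × Q) — A × (N × Q) — M × (N × C) — M × (B × C)
  P4-three-primes : ∀ {M N Q} → IsPrime A M → IsPrime B N → IsPrime C Q →
                    InducedP4 (PIS (A ×R (B ×R C)))
  P4-three-primes {M} {N} {Q} M-prime@(M-proper , _) N-prime@(N-proper , _) Q-prime@(Q-proper , _) =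
    a , b , c′ , d , (a≉b , a≉c , a≉d , b≉c , b≉d , c≉d) ,
    Adjacent-⊗ A.1ᴵ 1⊗Q A.1ᴵ N⊗Q A.1ᴵ 1⊗Q a≉b (A.+ᴵ-idem A.1ᴵ)
      (Inner.⊗-+ᴵ-≃ B.1ᴵ Q N Q B.1ᴵ Q (B.1ᴵ-+ᴵ N) (C.+ᴵ-idem Q))
      (1ᴵ⊗-prime {1⊗Q} (Inner.1ᴵ⊗-prime {Q} Q-prime)) ,
    Adjacent-⊗ A.1ᴵ N⊗Q M N⊗1 A.1ᴵ N⊗1 b≉c (A.1ᴵ-+ᴵ M)
      (Inner.⊗-+ᴵ-≃ N Q N C.1ᴵ N C.1ᴵ (B.+ᴵ-idem N) (C.+ᴵ-1ᴵ Q))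
      (1ᴵ⊗-prime {N⊗1} (Inner.⊗1ᴵ-prime {N} N-prime)) ,
    Adjacent-⊗ M N⊗1 M B×C.1ᴵ M B×C.1ᴵ c≉d (A.+ᴵ-idem M) (B×C.+ᴵ-1ᴵ N⊗1) (⊗1ᴵ-prime {M} M-prime) ,
    ¬Adjacent-⊗ A.1ᴵ 1⊗Q M N⊗1 A.1ᴵ (B.1ᴵ Inner.⊗ C.1ᴵ) (A.1ᴵ-+ᴵ M)
      (Inner.⊗-+ᴵ-≃ B.1ᴵ Q N C.1ᴵ B.1ᴵ C.1ᴵ (B.1ᴵ-+ᴵ N) (C.+ᴵ-1ᴵ Q))
      (A×B×C.unit⇒nonprime {A.1ᴵ ⊗ (B.1ᴵ Inner.⊗ C.1ᴵ)} _) ,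
    ¬Adjacent-⊗ A.1ᴵ 1⊗Q M B×C.1ᴵ A.1ᴵ B×C.1ᴵ (A.1ᴵ-+ᴵ M) (B×C.+ᴵ-1ᴵ 1⊗Q)
      (A×B×C.unit⇒nonprime {A.1ᴵ ⊗ B×C.1ᴵ} _) ,
    ¬Adjacent-⊗ A.1ᴵ N⊗Q M B×C.1ᴵ A.1ᴵ B×C.1ᴵ (A.1ᴵ-+ᴵ M) (B×C.+ᴵ-1ᴵ N⊗Q)
      (A×B×C.unit⇒nonprime {A.1ᴵ ⊗ B×C.1ᴵ} _)
    where
    1⊗Q N⊗Q N⊗1 : Ideal (B ×R C)
    1⊗Q = B.1ᴵ Inner.⊗ Q
    N⊗Q = N Inner.⊗ Q
    N⊗1 = N Inner.⊗ C.1ᴵ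
    1≢0 : IsNonzero A A.1ᴵ
    1≢0 = A.proper⇒1ᴵ-nonzero {M} M-proper
    a b c′ d : Graph.Vertex (PIS (A ×R (B ×R C)))
    a = A.1ᴵ ⊗ 1⊗Q , ⊗-nonzeroˡ {A.1ᴵ} {1⊗Q} 1≢0 ,
        ⊗-properʳ {A.1ᴵ} {1⊗Q} (Inner.⊗-properʳ {B.1ᴵ} {Q} Q-proper)
    b = A.1ᴵ ⊗ N⊗Q , ⊗-nonzeroˡ {A.1ᴵ} {N⊗Q} 1≢0 , ⊗-properʳ {A.1ᴵ} {N⊗Q} (Inner.⊗-properʳ {N} {Q} Q-proper)
    c′ = M ⊗ N⊗1 ,
         ⊗-nonzeroʳ {M} {N⊗1} (Inner.⊗-nonzeroʳ {N} {C.1ᴵ} (C.proper⇒1ᴵ-nonzero {Q} Q-proper)) ,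
         ⊗-properˡ {M} {N⊗1} M-proper
    d = M ⊗ B×C.1ᴵ ,
        ⊗-nonzeroʳ {M} {B×C.1ᴵ} (B×C.proper⇒1ᴵ-nonzero {N⊗1} (Inner.⊗-properˡ {N} {C.1ᴵ} N-proper)) ,
        ⊗-properˡ {M} {B×C.1ᴵ} M-proper
    1≄M : ¬ A.1ᴵ A.≃ M
    1≄M = A.proper⇒1ᴵ≄ {M} M-proper
    a≉b = ⊗-≄ʳ {A.1ᴵ} {A.1ᴵ} {1⊗Q} {N⊗Q} (Inner.⊗-≄ˡ {B.1ᴵ} {N} {Q} {Q} (B.proper⇒1ᴵ≄ {N} N-proper))
    a≉c = ⊗-≄ˡ {A.1ᴵ} {M} {1⊗Q} {N⊗1} 1≄M
    a≉d = ⊗-≄ˡ {A.1ᴵ} {M} {1⊗Q} {B×C.1ᴵ} 1≄M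
    b≉c = ⊗-≄ˡ {A.1ᴵ} {M} {N⊗Q} {N⊗1} 1≄M
    b≉d = ⊗-≄ˡ {A.1ᴵ} {M} {N⊗Q} {B×C.1ᴵ} 1≄M
    c≉d = ⊗-≄ʳ {M} {M} {N⊗1} {B×C.1ᴵ} (B×C.proper⇒≄1ᴵ {N⊗1} (Inner.⊗-properˡ {N} {C.1ᴵ} N-proper))

module LocalPair {c ℓ} (A B : CommutativeRing c ℓ) (em : ExcludedMiddle (c ⊔ ℓ))
                 (B-local : IsLocal B) where

  private
    module A = Ideals A
    module B = Ideals B
    M : Ideal B
    M = proj₁ B-local

  open ProductP4 A B
  open Local B em {M} (proj₁ (proj₂ B-local))

  cograph-domain×nonfield⇒onlyMaximal : IsCograph (PIS (A ×R B)) → IsPrime A A.0ᴵ → ¬ IsField B →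
                                        OnlyMaximalNonzeroProper B
  cograph-domain×nonfield⇒onlyMaximal cograph A-domain B-nonfield
    with onlyMaximal-or-nonprime-below (proj₂ (proj₂ B-local)) (¬field⇒M-nonzero B-nonfield)
  ... | inj₁ onlyMaximal = onlyMaximal
  ... | inj₂ nonprime =
    ⊥-elim (cograph (P4-domain×nonprime A-domain {M} M-prime (¬field⇒M-nonzero B-nonfield) nonprime))

  cograph-domain×nonfield⇒nondomain : IsCograph (PIS (A ×R B)) → IsPrime A A.0ᴵ → ¬ IsField B →
                                      ¬ IsPrime B B.0ᴵ
  cograph-domain×nonfield⇒nondomain cograph A-domain B-nonfield B-domain =
    cograph (P4-domain×nonprime A-domain {M} M-prime M≢0 (domain⇒nonprime-below B-domain M≢0))
    where
    M≢0 : IsNonzero B M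
    M≢0 = ¬field⇒M-nonzero B-nonfield

  cograph-nonfield×nonfield⇒domain : IsLocal A → IsCograph (PIS (A ×R B)) →
                                     ¬ IsField A → ¬ IsField B → IsPrime B B.0ᴵ
  cograph-nonfield×nonfield⇒domain (N , N-maximal , _) cograph A-nonfield B-nonfield
    with em {IsPrime B B.0ᴵ}
  ... | yes B-domain = B-domain
  ... | no B-nondomain = ⊥-elim (cograph (P4-primes×nondomain {N}
          (Local.M-prime A em {N} N-maximal) (Local.¬field⇒M-nonzero A em {N} N-maximal A-nonfield)
          {M} M-prime (¬field⇒M-nonzero B-nonfield) B-nondomain))

module CographLocalPair {c ℓ} (R A B : CommutativeRing c ℓ) (em : ExcludedMiddle (c ⊔ ℓ))
  (A-local : IsLocal A) (B-local : IsLocal B) (R≅A×B : R ≅ (A ×R B)) (cograph : IsCograph (PIS R)) where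

  private
    module AB = LocalPair A B em B-local
    module BA = LocalPair B A em A-local

  R≅B×A : R ≅ (B ×R A)
  R≅B×A = ≅-trans {R = R} {A ×R B} {B ×R A} R≅A×B (×R-comm A B)

  cograph-AB : IsCograph (PIS (A ×R B))
  cograph-AB = IsCograph-reflect (Preimage.PIS-preimage R≅A×B) cograph

  cograph-BA : IsCograph (PIS (B ×R A))
  cograph-BA = IsCograph-reflect (Preimage.PIS-preimage R≅B×A) cograph

  conditionIII : ConditionIII R
  conditionIII with em {IsField A} | em {IsField B}
  ... | yes A-field | yes B-field = inj₁ (A , B , A-field , B-field , R≅A×B)
  ... | yes A-field | no B-nonfield = inj₂ (A , B , A-field , B-local ,
    AB.cograph-domain×nonfield⇒onlyMaximal cograph-AB (Classical.field⇒0ᴵ-prime A em A-field) B-nonfield ,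
    R≅A×B)
  ... | no A-nonfield | yes B-field = inj₂ (B , A , B-field , A-local ,
    BA.cograph-domain×nonfield⇒onlyMaximal cograph-BA (Classical.field⇒0ᴵ-prime B em B-field) A-nonfield ,
    R≅B×A)
  ... | no A-nonfield | no B-nonfield =
    ⊥-elim (AB.cograph-domain×nonfield⇒nondomain cograph-AB
      (BA.cograph-nonfield×nonfield⇒domain B-local cograph-BA B-nonfield A-nonfield) B-nonfield
      (AB.cograph-nonfield×nonfield⇒domain A-local cograph-AB A-nonfield B-nonfield))

ΠRing-prime : ∀ {c ℓ} k (Rs : Fin (suc k) → CommutativeRing c ℓ) → ExcludedMiddle (c ⊔ ℓ) →
              IsLocal (Rs zero) → ∃[ P ] IsPrime (ΠRing k Rs) P
ΠRing-prime zero Rs em (M , M-maximal , _) = M , Classical.maximal⇒prime (Rs zero) em {M} M-maximal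
ΠRing-prime (suc k) Rs em (M , M-maximal , _) =
  M ⊗ B.1ᴵ , ⊗1ᴵ-prime {M} (Classical.maximal⇒prime (Rs zero) em {M} M-maximal)
  where open ProductIdeals (Rs zero) (ΠRing k (λ i → Rs (suc i)))

cograph⇒ConditionIII : ∀ {c ℓ} (R : CommutativeRing c ℓ) (m : ℕ)
  (Rs : Fin (suc (suc m)) → CommutativeRing c ℓ) → ExcludedMiddle (c ⊔ ℓ) → (∀ i → IsLocal (Rs i)) →
  R ≅ ΠRing (suc m) Rs → IsCograph (PIS R) → ConditionIII R
cograph⇒ConditionIII R zero Rs em Rs-local R≅ΠRs =
  CographLocalPair.conditionIII R (Rs zero) (Rs (suc zero)) em (Rs-local zero) (Rs-local (suc zero)) R≅ΠRs
cograph⇒ConditionIII R (suc k) Rs em Rs-local R≅ΠRs cograph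
  with Rs-local zero | Rs-local (suc zero)
     | ΠRing-prime k (λ i → Rs (suc (suc i))) em (Rs-local (suc (suc zero)))
... | M , M-maximal , _ | N , N-maximal , _ | Q , Q-prime =
  ⊥-elim (IsCograph-reflect (Preimage.PIS-preimage R≅ΠRs) cograph
    (ThreeFactorP4.P4-three-primes (Rs zero) (Rs (suc zero)) (ΠRing k (λ i → Rs (suc (suc i)))) {M} {N} {Q}
      (Classical.maximal⇒prime (Rs zero) em {M} M-maximal)
      (Classical.maximal⇒prime (Rs (suc zero)) em {N} N-maximal) Q-prime))

ConditionIII⇒threshold : ∀ {c ℓ} (R : CommutativeRing c ℓ) → ExcludedMiddle (c ⊔ ℓ) →
                         ConditionIII R → IsThreshold (PIS R)
ConditionIII⇒threshold R em (inj₁ (F₁ , F₂ , F₁-field , F₂-field , R≅F₁×F₂)) =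
  IsThreshold-reflect (Preimage.PIS-preimage (≅-sym {R = R} {F₁ ×R F₂} R≅F₁×F₂))
    (FieldProductThreshold.PIS-threshold F₁ F₂ em F₁-field {Ideals.0ᴵ F₂}
      (Classical.field⇒0ᴵ-prime F₂ em F₂-field)
      (Sum.map₂ inj₂ ∘ Classical.field⇒ideal-trivial F₂ em F₂-field))
ConditionIII⇒threshold R em (inj₂ (F₁ , R₂ , F₁-field , _ , onlyMaximal@(M , M-maximal , _) , R≅F₁×R₂)) =
  IsThreshold-reflect (Preimage.PIS-preimage (≅-sym {R = R} {F₁ ×R R₂} R≅F₁×R₂))
    (FieldProductThreshold.PIS-threshold F₁ R₂ em F₁-field {M} (Classical.maximal⇒prime R₂ em {M} M-maximal)
      (Classical.onlyMaximal⇒onlyIdeals R₂ em onlyMaximal))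

mainTheorem3 : ∀ {c ℓ} (R : CommutativeRing c ℓ) (m : ℕ)
    (Rs : Fin (suc (suc m)) → CommutativeRing c ℓ) →
    (∀ i → IsLocal (Rs i)) →
    R ≅ ΠRing (suc m) Rs →
    (IsThreshold (PIS R) ⇔ IsCograph (PIS R)) × (IsCograph (PIS R) ⇔ ConditionIII R)
mainTheorem3 R m Rs Rs-local R≅ΠRs =
  mk⇔ proj₁ (threshold ∘ condition) , mk⇔ condition (proj₁ ∘ threshold)
  where
  em : ExcludedMiddle _
  em = Ideals.maximal⇒excludedMiddle (Rs zero) {proj₁ (Rs-local zero)} (proj₁ (proj₂ (Rs-local zero)))
  condition : IsCograph (PIS R) → ConditionIII R
  condition = cograph⇒ConditionIII R m Rs em Rs-local R≅ΠRs
  threshold : ConditionIII R → IsThreshold (PIS R)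
  threshold = ConditionIII⇒threshold R em
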